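{- Let $r$ be a nonzero integer and let $c(n;r)=\sum_{j\ge0}\binom{n}{j}^2r^j-\sum_{j\ge0}\binom{n+1}{j}\binom{n-1}{j}r^j$ ($n\ge0$) be the generalized Catalan numbers. Let $P(r)=(p_{i,j})_{i,j\ge0}$ be the infinite matrix with $p_{i,0}=0$ for all $i$, $p_{0,1}=r$, $p_{0,j}=0$ for $j\ge2$, and for $i\ge1$: $p_{i,j}=1$ for $1\le j\le i$, $p_{i,i+1}=r$, $p_{i,j}=0$ for $j\ge i+2$. Let $A_P(r)$ be the lower triangular matrix whose row $0$ is $(1,0,0,\dots)$ and whose row $n+1$ is (row $n$)$\cdot P(r)$. Then: (i) $P(r)$ is the production matrix of $c(n;r)$, i.e. the $n$-th row sum of $A_P(r)$ equals $c(n;r)$ for every $n\ge0$; (ii) $A_P(r)=\left(1,\frac{x(1-x)}{r-(r-1)x}\right)^{ -1}=\left(1,\frac{1+(r-1)x-\sqrt{1-2(r+1)x+(r-1)^2x^2}}{2}\right)$; (iii) the matrix $L(r)=A_P(r)\,B\,(1,x/r)$ is the Riordan array $$L(r)=\left(\frac{1-(r-1)x-\sqrt{1-2(r+1)x+(r-1)^2x^2}}{2x},\ \frac{1-(r+1)x-\sqrt{1-2(r+1)x+(r-1)^2x^2}}{2rx}\right)=\left(\frac{1}{1+rx},\frac{x}{1+(r+1)x+rx^2}\right)^{ -1},$$ and the Hankel matrix $H(r)=\big(c(i+j;r)\big)_{i,j\ge0}$ satisfies $H(r)=L(r)D(r)L(r)^T$, where $D(r)$ is the diagonal matrix with $n$-th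 diagonal entry $r^n$ ($n\ge0$).
   Context: A Riordan array $(g(x),f(x))$, with $g,f$ formal power series, $g(0)\neq 0$, $f(0)=0$, $f'(0)\ne0$, is the infinite lower triangular matrix whose $(n,k)$ entry ($n,k\ge0$) is the coefficient of $x^n$ in $g(x)f(x)^k$. Riordan arrays multiply by $(g,f)(h,l)=(g\cdot h(f),\,l(f))$, and $(g,f)^{ -1}$ denotes the matrix inverse, which is again a Riordan array. $B=\left(\frac{1}{1-x},\frac{x}{1-x}\right)$ is the binomial (Pascal) matrix with entries $\binom{n}{k}$, and $(1,x/r)$ is the diagonal matrix with entries $r^{ -n}$. Square roots of formal power series with constant term $1$ are taken with constant term $1$. -}

module Defs where

open import Data.Nat as ℕ using (ℕ; zero; suc; _∸_)
open import Data.Nat.Combinatorics using (_C_)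
open import Data.Integer as ℤ using (ℤ; +_)
open import Data.Rational as ℚ using (ℚ; 0ℚ; 1ℚ; ½; _+_; _*_; _-_; -_; 1/_; ≢-nonZero)
open import Data.Rational.Properties using (_≟_)
open import Data.List using (List; []; _∷_)
open import Data.Bool using (if_then_else_)
open import Relation.Nullary using (yes; no; ⌊_⌋)
open import Relation.Binary.PropositionalEquality using (_≡_)

ι : ℤ → ℚ
ι z = z ℚ./ 1

ιℕ : ℕ → ℚ
ιℕ n = ι (+ n)

_^ℚ_ : ℚ → ℕ → ℚ
p ^ℚ zero  = 1ℚ
p ^ℚ suc n = p * (p ^ℚ n)

-- total reciprocal: 1/p for p ≠ 0 (only ever used with p ≠ 0)
recip : ℚ → ℚ
recip p with p ≟ 0ℚ
... | yes _  = 0ℚ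
... | no p≢0 = 1/_ p {{≢-nonZero p≢0}}

sumTo : ℕ → (ℕ → ℚ) → ℚ
sumTo zero    f = 0ℚ
sumTo (suc n) f = sumTo n f + f n

Series : Set
Series = ℕ → ℚ

-- polynomial with the given list of coefficients (constant term first)
poly : List ℚ → Series
poly []       n       = 0ℚ
poly (a ∷ as) zero    = a
poly (a ∷ as) (suc n) = poly as n

_⊕_ : Series → Series → Series
(f ⊕ g) n = f n + g n

_⊖_ : Series → Series → Series
(f ⊖ g) n = f n - g n

_·_ : ℚ → Series → Series
(c · f) n = c * f n

_⊛_ : Series → Series → Series
(f ⊛ g) n = sumTo (suc n) (λ k → f k * g (n ∸ k))

_^S_ : Series → ℕ → Series
f ^S zero  = poly (1ℚ ∷ [])
f ^S suc k = f ⊛ (f ^S k)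

-- division by x (for series with zero constant term): coefficient shift
divX : Series → Series
divX f n = f (suc n)

-- course-of-values recursion: value at 0 is `base`; value at (suc n) is
-- `step n b` where b agrees with the sequence on indices ≤ n.
private
  upTo : ℚ → (ℕ → (ℕ → ℚ) → ℚ) → ℕ → (ℕ → ℚ)
  upTo base step zero    = λ _ → base
  upTo base step (suc n) = λ i →
    if ⌊ i ℕ.≟ suc n ⌋ then step n (upTo base step n) else upTo base step n i

cov : ℚ → (ℕ → (ℕ → ℚ) → ℚ) → Series
cov base step n = upTo base step n n

-- multiplicative inverse 1/a of a series with a 0 ≠ 0:
--   b 0 = 1 / a 0,   b m = -(1/a 0) * Σ_{k=1}^{m} a k * b (m-k)   (m ≥ 1)
invS : Series → Series
invS a = cov (recip (a 0)) (λ n b →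
  - (recip (a 0) * sumTo (suc n) (λ k → a (suc k) * b (n ∸ k))))

-- square root with constant term 1 of a series with a 0 = 1:
--   s 0 = 1,   s m = ½ (a m - Σ_{k=1}^{m-1} s k * s (m-k))   (m ≥ 1)
sqrtS : Series → Series
sqrtS a = cov 1ℚ (λ n s →
  ½ * (a (suc n) - sumTo n (λ k → s (suc k) * s (n ∸ k))))

Matrix : Set
Matrix = ℕ → ℕ → ℚ

_≐_ : Matrix → Matrix → Set
M ≐ N = ∀ n k → M n k ≡ N n k

-- product of infinite matrices whose LEFT factor is lower triangular:
-- (M ⊙ N) n k = Σ_{j=0}^{n} M n j * N j k  (the terms j > n vanish)
_⊙_ : Matrix → Matrix → Matrix
(M ⊙ N) n k = sumTo (suc n) (λ j → M n j * N j k)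

transpose : Matrix → Matrix
transpose M n k = M k n

diag : Series → Matrix
diag d n k = if ⌊ n ℕ.≟ k ⌋ then d n else 0ℚ

I : Matrix
I = diag (λ _ → 1ℚ)

Riordan : Series → Series → Matrix
Riordan g f n k = (g ⊛ (f ^S k)) n

oneS : Series
oneS = poly (1ℚ ∷ [])

xS : Series
xS = poly (0ℚ ∷ 1ℚ ∷ [])

B : Matrix
B n k = ιℕ (n C k)

-- generalized Catalan numbers
--   c(n;r) = Σ_{j≥0} C(n,j)^2 r^j - Σ_{j≥0} C(n+1,j) C(n-1,j) r^j
-- All terms with j > n+1 vanish.  For n = 0 the second sum involves
-- C(-1,j), which is 0 (combinatorial convention), so that sum is 0.
catalanGen : ℤ → ℕ → ℚ
catalanGen r n = sum₁ n - sum₂ n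
  where
    sum₁ : ℕ → ℚ
    sum₁ n = sumTo (suc (suc n)) (λ j → ιℕ ((n C j) ℕ.* (n C j)) * (ι r ^ℚ j))
    sum₂ : ℕ → ℚ
    sum₂ zero    = 0ℚ
    sum₂ (suc m) = sumTo (suc (suc (suc m)))
                     (λ j → ιℕ ((suc (suc m) C j) ℕ.* (m C j)) * (ι r ^ℚ j))

Pmat : ℤ → Matrix
Pmat r zero    zero    = 0ℚ
Pmat r zero    (suc zero) = ι r
Pmat r zero    (suc (suc j)) = 0ℚ
Pmat r (suc i) zero    = 0ℚ
Pmat r (suc i) (suc j) with ℕ.compare j i
... | ℕ.less _ _    = 1ℚ      -- column j+1 ≤ i   (row i+1)
... | ℕ.equal _     = 1ℚ      -- column j+1 = i+1
... | ℕ.greater _ k with k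
...   | zero  = ι r           -- column j+1 = i+2
...   | suc _ = 0ℚ            -- column j+1 ≥ i+3

-- A_P(r): row 0 is (1,0,0,…), row n+1 is (row n)·P(r).
-- Row n of A_P(r) vanishes beyond column n (A_P is lower triangular), so
-- the vector-matrix product only needs the terms i ≤ n.
AP : ℤ → Matrix
AP r zero    k = if ⌊ k ℕ.≟ 0 ⌋ then 1ℚ else 0ℚ
AP r (suc n) k = sumTo (suc n) (λ i → AP r n i * Pmat r i k)

Δ : ℤ → Series
Δ r = poly (1ℚ ∷ (- (ιℕ 2 * (ι r + 1ℚ))) ∷ ((ι r - 1ℚ) * (ι r - 1ℚ)) ∷ [])

sqrtΔ : ℤ → Series
sqrtΔ r = sqrtS (Δ r)

-- the diagonal matrix (1, x/r) with entries r^{-n}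
Dinv : ℤ → Matrix
Dinv r = Riordan oneS (recip (ι r) · xS)

L : ℤ → Matrix
L r = (AP r ⊙ B) ⊙ Dinv r

D : ℤ → Matrix
D r = diag (λ n → ι r ^ℚ n)

H : ℤ → Matrix
H r i j = catalanGen r (i ℕ.+ j)

Fii : ℤ → Series
Fii r = (xS ⊛ poly (1ℚ ∷ (- 1ℚ) ∷ [])) ⊛ invS (poly (ι r ∷ (- (ι r - 1ℚ)) ∷ []))

Gii : ℤ → Series
Gii r = ½ · (poly (1ℚ ∷ (ι r - 1ℚ) ∷ []) ⊖ sqrtΔ r)

gL : ℤ → Series
gL r = divX (½ · (poly (1ℚ ∷ (- (ι r - 1ℚ)) ∷ []) ⊖ sqrtΔ r))

fL : ℤ → Series
fL r = divX (recip (ιℕ 2 * ι r) · (poly (1ℚ ∷ (- (ι r + 1ℚ)) ∷ []) ⊖ sqrtΔ r))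

Niii : ℤ → Matrix
Niii r = Riordan (invS (poly (1ℚ ∷ ι r ∷ [])))
                 (xS ⊛ invS (poly (1ℚ ∷ (ι r + 1ℚ) ∷ ι r ∷ [])))

-- G = (1 + (r-1)x - √Δ)/2 solves G(1 - G) = x(r - (r-1)G). Multiplying by Gʲ
-- shows that consecutive columns of (1, G) differ exactly as consecutive
-- columns of P(r) do (their difference is supported on two rows), so (1, G)
-- obeys the production rule that defines A_P(r); the same equation says that
-- x(1-x)/(r-(r-1)x) composed with G is x, which inverts (1, G).
--
-- By the hockey-stick identity P(r) B = B T with T tridiagonal, and after
-- scaling column k by r⁻ᵏ the rows of L(r) satisfy a three-term recurrence
-- whose production matrix has superdiagonal 1, diagonal (r, r+1, r+1, …) and
-- subdiagonal r. The identities g_L = 1 + r f_L and f_L = x(1 + f_L) g_L show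
-- that (g_L, f_L) obeys the same recurrence, and the usual telescoping for
-- tridiagonal production matrices gives H = L D Lᵀ once column 0 of L, the row
-- sums of A_P(r), is identified with c(n; r). For that, row m+1 of A_P(r) B is
-- read off the coefficients of x(1+x)^(m+1)(1+rx)^(m+1) - (1+x)^(m+2)(1+rx)^m,
-- whose coefficient of x^(m+2) is c(m+1; r) by the binomial theorem.

module Submission where

open import Defs
open import Algebra.Bundles using (CommutativeRing)
import Algebra.Properties.Group as GroupProperties
import Algebra.Solver.Ring.AlmostCommutativeRing as ACR
open import Algebra.Structures using (IsCommutativeRing)
open import Data.Bool using (if_then_else_)
open import Data.Integer as ℤ using (ℤ)
import Data.Integer.Properties as ℤP
open import Data.List using ([]; _∷_)
import Data.Maybe as Maybe
open import Data.Nat as ℕ using (ℕ; zero; suc; _≤_; _<_; z≤n; s≤s; _∸_)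
open import Data.Nat.Combinatorics using (_C_; k>n⇒nCk≡0; nCk+nC[k+1]≡[n+1]C[k+1]; nCk≡nC[n∸k])
open import Data.Nat.Coprimality as Coprimality using (1-coprimeTo)
import Data.Nat.Properties as ℕP
open import Data.Product using (_×_; _,_)
open import Data.Rational as ℚ using (ℚ; 0ℚ; 1ℚ; ½; _+_; _*_; _-_; -_; mkℚ)
import Data.Rational.Properties as ℚP
open import Data.Sum using (inj₁; inj₂)
open import Relation.Binary using (tri<; tri≈; tri>)
open import Relation.Binary.PropositionalEquality
import Relation.Binary.Reasoning.Setoid as SetoidReasoning
open import Relation.Nullary using (yes; no; ⌊_⌋; contradiction)
open import Relation.Nullary.Decidable using (dec⇒maybe)
open import Tactic.RingSolver using (solve-∀)
import Tactic.RingSolver.Core.AlmostCommutativeRing as TACR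

ℚ-ring : TACR.AlmostCommutativeRing _ _
ℚ-ring = TACR.fromCommutativeRing ℚP.+-*-commutativeRing (λ x → dec⇒maybe (0ℚ ℚP.≟ x))

-- Finite sums

sumTo-cong-< : ∀ N {f g : ℕ → ℚ} → (∀ i → i < N → f i ≡ g i) → sumTo N f ≡ sumTo N g
sumTo-cong-< zero    eq = refl
sumTo-cong-< (suc N) eq = cong₂ _+_ (sumTo-cong-< N (λ i i<N → eq i (ℕP.m<n⇒m<1+n i<N))) (eq N ℕP.≤-refl)

sumTo-cong : ∀ N {f g : ℕ → ℚ} → (∀ i → f i ≡ g i) → sumTo N f ≡ sumTo N g
sumTo-cong N eq = sumTo-cong-< N (λ i _ → eq i)

sumTo-zero : ∀ N {f : ℕ → ℚ} → (∀ i → i < N → f i ≡ 0ℚ) → sumTo N f ≡ 0ℚ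
sumTo-zero zero    eq = refl
sumTo-zero (suc N) eq =
  trans (cong₂ _+_ (sumTo-zero N (λ i i<N → eq i (ℕP.m<n⇒m<1+n i<N))) (eq N ℕP.≤-refl)) (ℚP.+-identityˡ 0ℚ)

sumTo-+ : ∀ N (f g : ℕ → ℚ) → sumTo N (λ i → f i + g i) ≡ sumTo N f + sumTo N g
sumTo-+ zero    f g = refl
sumTo-+ (suc N) f g = trans (cong (_+ (f N + g N)) (sumTo-+ N f g)) (interchange (sumTo N f) (sumTo N g) (f N) (g N))
  where
  interchange : ∀ a b c d → (a + b) + (c + d) ≡ (a + c) + (b + d)
  interchange = solve-∀ ℚ-ring

sumTo-*ˡ : ∀ N (c : ℚ) (f : ℕ → ℚ) → sumTo N (λ i → c * f i) ≡ c * sumTo N f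
sumTo-*ˡ zero    c f = sym (ℚP.*-zeroʳ c)
sumTo-*ˡ (suc N) c f = trans (cong (_+ (c * f N)) (sumTo-*ˡ N c f)) (sym (ℚP.*-distribˡ-+ c (sumTo N f) (f N)))

sumTo-*ʳ : ∀ N (c : ℚ) (f : ℕ → ℚ) → sumTo N (λ i → f i * c) ≡ sumTo N f * c
sumTo-*ʳ N c f = trans (sumTo-cong N (λ i → ℚP.*-comm (f i) c)) (trans (sumTo-*ˡ N c f) (ℚP.*-comm c _))

sumTo-neg : ∀ N (f : ℕ → ℚ) → sumTo N (λ i → - f i) ≡ - sumTo N f
sumTo-neg zero    f = refl
sumTo-neg (suc N) f = trans (cong (_+ (- f N)) (sumTo-neg N f)) (sym (ℚP.neg-distrib-+ (sumTo N f) (f N)))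

sumTo-head : ∀ N (f : ℕ → ℚ) → sumTo (suc N) f ≡ f 0 + sumTo N (λ i → f (suc i))
sumTo-head zero    f = trans (ℚP.+-identityˡ (f 0)) (sym (ℚP.+-identityʳ (f 0)))
sumTo-head (suc N) f = trans (cong (_+ f (suc N)) (sumTo-head N f)) (ℚP.+-assoc (f 0) _ _)

sumTo-swap : ∀ N M (φ : ℕ → ℕ → ℚ) → sumTo N (λ i → sumTo M (φ i)) ≡ sumTo M (λ j → sumTo N (λ i → φ i j))
sumTo-swap zero    M φ = sym (sumTo-zero M (λ _ _ → refl))
sumTo-swap (suc N) M φ =
  trans (cong (_+ sumTo M (φ N)) (sumTo-swap N M φ)) (sym (sumTo-+ M (λ j → sumTo N (λ i → φ i j)) (φ N)))

sumTo-extend : ∀ {N} M (f : ℕ → ℚ) → N ≤ M → (∀ i → N ≤ i → i < M → f i ≡ 0ℚ) → sumTo N f ≡ sumTo M f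
sumTo-extend zero    f z≤n   vanish = refl
sumTo-extend (suc M) f N≤1+M vanish with ℕP.m≤n⇒m<n∨m≡n N≤1+M
... | inj₂ refl       = refl
... | inj₁ (s≤s N≤M) =
  trans (sumTo-extend M f N≤M (λ i N≤i i<M → vanish i N≤i (ℕP.m<n⇒m<1+n i<M)))
        (sym (trans (cong (sumTo M f +_) (vanish M N≤M ℕP.≤-refl)) (ℚP.+-identityʳ _)))

sumTo-single : ∀ N (f : ℕ → ℚ) k → k < N → (∀ i → i < N → i ≢ k → f i ≡ 0ℚ) → sumTo N f ≡ f k
sumTo-single (suc N) f k k<1+N vanish with k ℕP.≟ N
... | yes refl =
  trans (cong (_+ f k) (sumTo-zero N (λ i i<N → vanish i (ℕP.m<n⇒m<1+n i<N) (λ { refl → ℕP.<-irrefl refl i<N }))))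
        (ℚP.+-identityˡ _)
... | no k≢N =
  trans (cong₂ _+_ (sumTo-single N f k (ℕP.≤∧≢⇒< (ℕP.≤-pred k<1+N) k≢N) (λ i i<N → vanish i (ℕP.m<n⇒m<1+n i<N)))
                   (vanish N ℕP.≤-refl (λ N≡k → k≢N (sym N≡k))))
        (ℚP.+-identityʳ _)

sumTo-telescope : ∀ N (a : ℕ → ℚ) → sumTo N (λ m → a m - a (suc m)) ≡ a 0 - a N
sumTo-telescope zero    a = sym (ℚP.+-inverseʳ (a 0))
sumTo-telescope (suc N) a = trans (cong (_+ (a N - a (suc N))) (sumTo-telescope N a)) (collapse (a 0) (a N) (a (suc N)))
  where
  collapse : ∀ x y z → x - y + (y - z) ≡ x - z
  collapse = solve-∀ ℚ-ring

open GroupProperties ℚP.+-0-group using () renaming (∙-cancelˡ to +-cancelˡ)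

recip-inverseʳ : ∀ a → a ≢ 0ℚ → a * recip a ≡ 1ℚ
recip-inverseʳ a a≢0 with a ℚP.≟ 0ℚ
... | yes a≡0 = contradiction a≡0 a≢0
... | no  a≢0 = ℚP.*-inverseʳ a {{ℚ.≢-nonZero a≢0}}

*-cancelˡ-≢0 : ∀ a {x y} → a ≢ 0ℚ → a * x ≡ a * y → x ≡ y
*-cancelˡ-≢0 a {x} {y} a≢0 ax≡ay =
  trans (sym (unscale x)) (trans (cong (recip a *_) ax≡ay) (unscale y))
  where
  unscale : ∀ z → recip a * (a * z) ≡ z
  unscale z = trans (sym (ℚP.*-assoc (recip a) a z))
                (trans (cong (_* z) (trans (ℚP.*-comm (recip a) a) (recip-inverseʳ a a≢0))) (ℚP.*-identityˡ z))

ιℕ≡mkℚ : ∀ n → ιℕ n ≡ mkℚ (ℤ.+ n) 0 (Coprimality.sym (1-coprimeTo n))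
ιℕ≡mkℚ n = ℚP.normalize-coprime (Coprimality.sym (1-coprimeTo n))

ιℕ-+ : ∀ m n → ιℕ (m ℕ.+ n) ≡ ιℕ m + ιℕ n
ιℕ-+ m n = sym (trans (cong₂ _+_ (ιℕ≡mkℚ m) (ιℕ≡mkℚ n))
  (ℚP./-cong {(ℤ.+ m) ℤ.* (ℤ.+ 1) ℤ.+ (ℤ.+ n) ℤ.* (ℤ.+ 1)} {1} {ℤ.+ (m ℕ.+ n)} {1}
    (trans (cong₂ ℤ._+_ (ℤP.*-identityʳ (ℤ.+ m)) (ℤP.*-identityʳ (ℤ.+ n))) (sym (ℤP.pos-+ m n))) refl))

ιℕ-* : ∀ m n → ιℕ (m ℕ.* n) ≡ ιℕ m * ιℕ n
ιℕ-* m n = sym (trans (cong₂ _*_ (ιℕ≡mkℚ m) (ιℕ≡mkℚ n))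
  (ℚP./-cong {(ℤ.+ m) ℤ.* (ℤ.+ n)} {1} {ℤ.+ (m ℕ.* n)} {1} (sym (ℤP.pos-* m n)) refl))

ι≢0 : ∀ r → r ≢ ℤ.+ 0 → ι r ≢ 0ℚ
ι≢0 (ℤ.+ zero)    r≢0 _ = r≢0 refl
ι≢0 (ℤ.+ suc n)   r≢0 e with trans (sym (ιℕ≡mkℚ (suc n))) e
... | ()
ι≢0 ℤ.-[1+ n ]    r≢0 e with trans (cong -_ (sym (ιℕ≡mkℚ (suc n)))) e
... | ()

-- Formal power series

infix 4 _≈_
record _≈_ (f g : Series) : Set where
  constructor mk
  field at : ∀ n → f n ≡ g n
open _≈_

≈-refl : ∀ {f} → f ≈ f
≈-refl = mk λ n → refl

≈-sym : ∀ {f g} → f ≈ g → g ≈ f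
≈-sym p = mk λ n → sym (at p n)

≈-trans : ∀ {f g h} → f ≈ g → g ≈ h → f ≈ h
≈-trans p q = mk λ n → trans (at p n) (at q n)

zeroS : Series
zeroS _ = 0ℚ

negS : Series → Series
negS f n = - f n

⊛-0 : ∀ f g → (f ⊛ g) 0 ≡ f 0 * g 0
⊛-0 f g = ℚP.+-identityˡ _

⊛-suc : ∀ f g n → (f ⊛ g) (suc n) ≡ f 0 * g (suc n) + (divX f ⊛ g) n
⊛-suc f g n = sumTo-head (suc n) (λ k → f k * g (suc n ∸ k))

⊛-cong : ∀ {f f' g g'} → f ≈ f' → g ≈ g' → (f ⊛ g) ≈ (f' ⊛ g')
⊛-cong p q = mk λ n → sumTo-cong (suc n) (λ k → cong₂ _*_ (at p k) (at q (n ∸ k)))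

⊛-congˡ : ∀ {f f'} g → f ≈ f' → (f ⊛ g) ≈ (f' ⊛ g)
⊛-congˡ g p = ⊛-cong p (≈-refl {g})

⊛-congʳ : ∀ f {g g'} → g ≈ g' → (f ⊛ g) ≈ (f ⊛ g')
⊛-congʳ f q = ⊛-cong (≈-refl {f}) q

⊛-comm-at : ∀ f g n → (f ⊛ g) n ≡ (g ⊛ f) n
⊛-comm-at f g zero = trans (⊛-0 f g) (trans (ℚP.*-comm (f 0) (g 0)) (sym (⊛-0 g f)))
⊛-comm-at f g (suc zero) =
  trans (⊛-suc f g 0) (trans (cong (f 0 * g 1 +_) (⊛-0 (divX f) g))
  (trans (swap (f 0) (g 1) (f 1) (g 0)) (sym (trans (⊛-suc g f 0) (cong (g 0 * f 1 +_) (⊛-0 (divX g) f))))))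
  where
  swap : ∀ a b c d → a * b + c * d ≡ d * c + b * a
  swap = solve-∀ ℚ-ring
⊛-comm-at f g (suc (suc n)) =
  trans (⊛-suc f g (suc n)) (trans (cong (f 0 * g (suc (suc n)) +_) (trans (⊛-comm-at (divX f) g (suc n)) (⊛-suc g (divX f) n)))
  (trans (cong (λ z → f 0 * g (suc (suc n)) + (g 0 * f (suc (suc n)) + z)) (⊛-comm-at (divX g) (divX f) n))
  (trans (swap (f 0) (g (suc (suc n))) (g 0) (f (suc (suc n))) ((divX f ⊛ divX g) n))
  (sym (trans (⊛-suc g f (suc n)) (cong (g 0 * f (suc (suc n)) +_) (trans (⊛-comm-at (divX g) f (suc n)) (⊛-suc f (divX g) n))))))))
  where
  swap : ∀ a b c d e → a * b + (c * d + e) ≡ c * d + (a * b + e)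
  swap = solve-∀ ℚ-ring

⊛-comm : ∀ f g → (f ⊛ g) ≈ (g ⊛ f)
⊛-comm f g = mk (⊛-comm-at f g)

⊛-distribʳ : ∀ f g h → ((f ⊕ g) ⊛ h) ≈ ((f ⊛ h) ⊕ (g ⊛ h))
⊛-distribʳ f g h = mk λ n →
  trans (sumTo-cong (suc n) (λ k → ℚP.*-distribʳ-+ (h (n ∸ k)) (f k) (g k))) (sumTo-+ (suc n) _ _)

⊛-distribˡ : ∀ f g h → (f ⊛ (g ⊕ h)) ≈ ((f ⊛ g) ⊕ (f ⊛ h))
⊛-distribˡ f g h = mk λ n →
  trans (sumTo-cong (suc n) (λ k → ℚP.*-distribˡ-+ (f k) (g (n ∸ k)) (h (n ∸ k)))) (sumTo-+ (suc n) _ _)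

⊛-scalˡ : ∀ c f g → ((c · f) ⊛ g) ≈ (c · (f ⊛ g))
⊛-scalˡ c f g = mk λ n → trans (sumTo-cong (suc n) (λ k → ℚP.*-assoc c (f k) (g (n ∸ k)))) (sumTo-*ˡ (suc n) c _)

⊛-scalʳ : ∀ c f g → (f ⊛ (c · g)) ≈ (c · (f ⊛ g))
⊛-scalʳ c f g = mk λ n → trans (sumTo-cong (suc n) (λ k → swap (f k) c (g (n ∸ k)))) (sumTo-*ˡ (suc n) c _)
  where
  swap : ∀ a b d → a * (b * d) ≡ b * (a * d)
  swap = solve-∀ ℚ-ring

⊛-negˡ : ∀ f g → (negS f ⊛ g) ≈ negS (f ⊛ g)
⊛-negˡ f g = mk λ n → trans (sumTo-cong (suc n) (λ k → sym (ℚP.neg-distribˡ-* (f k) (g (n ∸ k))))) (sumTo-neg (suc n) _)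

⊛-zeroˡ : ∀ f → (zeroS ⊛ f) ≈ zeroS
⊛-zeroˡ f = mk λ n → sumTo-zero (suc n) (λ k _ → ℚP.*-zeroˡ (f (n ∸ k)))

⊛-zeroʳ : ∀ f → (f ⊛ zeroS) ≈ zeroS
⊛-zeroʳ f = ≈-trans (⊛-comm f zeroS) (⊛-zeroˡ f)

⊛-identityˡ-at : ∀ f n → (oneS ⊛ f) n ≡ f n
⊛-identityˡ-at f zero    = trans (⊛-0 oneS f) (ℚP.*-identityˡ _)
⊛-identityˡ-at f (suc n) =
  trans (⊛-suc oneS f n) (trans (cong₂ _+_ (ℚP.*-identityˡ (f (suc n))) (at (⊛-zeroˡ f) n)) (ℚP.+-identityʳ (f (suc n))))

⊛-identityˡ : ∀ f → (oneS ⊛ f) ≈ f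
⊛-identityˡ f = mk (⊛-identityˡ-at f)

⊛-identityʳ : ∀ f → (f ⊛ oneS) ≈ f
⊛-identityʳ f = ≈-trans (⊛-comm f oneS) (⊛-identityˡ f)

xS⊛-0 : ∀ f → (xS ⊛ f) 0 ≡ 0ℚ
xS⊛-0 f = trans (⊛-0 xS f) (ℚP.*-zeroˡ (f 0))

xS⊛-suc : ∀ f n → (xS ⊛ f) (suc n) ≡ f n
xS⊛-suc f n = trans (⊛-suc xS f n) (trans (cong₂ _+_ (ℚP.*-zeroˡ (f (suc n))) (⊛-identityˡ-at f n)) (ℚP.+-identityˡ (f n)))

xS⊛-cancel : ∀ {f g} → (xS ⊛ f) ≈ (xS ⊛ g) → f ≈ g
xS⊛-cancel {f} {g} p = mk λ n → trans (sym (xS⊛-suc f n)) (trans (at p (suc n)) (xS⊛-suc g n))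

xS⊛-divX : ∀ f → f 0 ≡ 0ℚ → f ≈ (xS ⊛ divX f)
xS⊛-divX f f0≡0 = mk λ where
  zero    → trans f0≡0 (sym (xS⊛-0 (divX f)))
  (suc n) → sym (xS⊛-suc (divX f) n)

divX-⊛ : ∀ f g → divX (f ⊛ g) ≈ ((f 0 · divX g) ⊕ (divX f ⊛ g))
divX-⊛ f g = mk λ n → ⊛-suc f g n

⊛-assoc-at : ∀ f g h n → ((f ⊛ g) ⊛ h) n ≡ (f ⊛ (g ⊛ h)) n
⊛-assoc-at f g h zero = trans (⊛-0 (f ⊛ g) h) (trans (cong (_* h 0) (⊛-0 f g))
  (trans (ℚP.*-assoc (f 0) (g 0) (h 0)) (sym (trans (⊛-0 f (g ⊛ h)) (cong (f 0 *_) (⊛-0 g h))))))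
⊛-assoc-at f g h (suc n) =
  trans (⊛-suc (f ⊛ g) h n)
  (trans (cong₂ _+_ (cong (_* h (suc n)) (⊛-0 f g))
           (trans (at (⊛-congˡ h (divX-⊛ f g)) n)
           (trans (at (⊛-distribʳ (f 0 · divX g) (divX f ⊛ g) h) n)
             (cong₂ _+_ (at (⊛-scalˡ (f 0) (divX g) h) n) (⊛-assoc-at (divX f) g h n)))))
  (trans (regroup (f 0) (g 0) (h (suc n)) ((divX g ⊛ h) n) ((divX f ⊛ (g ⊛ h)) n))
  (sym (trans (⊛-suc f (g ⊛ h) n) (cong (λ z → f 0 * z + (divX f ⊛ (g ⊛ h)) n) (⊛-suc g h n))))))
  where
  regroup : ∀ a b c d e → a * b * c + (a * d + e) ≡ a * (b * c + d) + e
  regroup = solve-∀ ℚ-ring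

⊛-assoc : ∀ f g h → ((f ⊛ g) ⊛ h) ≈ (f ⊛ (g ⊛ h))
⊛-assoc f g h = mk (⊛-assoc-at f g h)

^S-cong : ∀ {f g} k → f ≈ g → (f ^S k) ≈ (g ^S k)
^S-cong zero    p = ≈-refl
^S-cong (suc k) p = ⊛-cong p (^S-cong k p)

⊕-cong : ∀ {a a' b b'} → a ≈ a' → b ≈ b' → (a ⊕ b) ≈ (a' ⊕ b')
⊕-cong p q = mk λ n → cong₂ _+_ (at p n) (at q n)

⊖-cong : ∀ {a a' b b'} → a ≈ a' → b ≈ b' → (a ⊖ b) ≈ (a' ⊖ b')
⊖-cong p q = mk λ n → cong₂ _-_ (at p n) (at q n)

negS-cong : ∀ {a a'} → a ≈ a' → negS a ≈ negS a'
negS-cong p = mk λ n → cong -_ (at p n)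

·-cong : ∀ c {a a'} → a ≈ a' → (c · a) ≈ (c · a')
·-cong c p = mk λ n → cong (c *_) (at p n)

series-isCommutativeRing : IsCommutativeRing _≈_ _⊕_ _⊛_ negS zeroS oneS
series-isCommutativeRing = record
  { isRing = record
    { +-isAbelianGroup = record
      { isGroup = record
        { isMonoid = record
          { isSemigroup = record
            { isMagma = record
              { isEquivalence = record { refl = ≈-refl ; sym = ≈-sym ; trans = ≈-trans }
              ; ∙-cong = ⊕-cong }
            ; assoc = λ f g h → mk λ n → ℚP.+-assoc (f n) (g n) (h n) }
          ; identity = (λ f → mk λ n → ℚP.+-identityˡ (f n)) , (λ f → mk λ n → ℚP.+-identityʳ (f n)) }
        ; inverse = (λ f → mk λ n → ℚP.+-inverseˡ (f n)) , (λ f → mk λ n → ℚP.+-inverseʳ (f n))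
        ; ⁻¹-cong = negS-cong }
      ; comm = λ f g → mk λ n → ℚP.+-comm (f n) (g n) }
    ; *-cong = ⊛-cong
    ; *-assoc = ⊛-assoc
    ; *-identity = ⊛-identityˡ , ⊛-identityʳ
    ; distrib = ⊛-distribˡ , (λ h f g → ⊛-distribʳ f g h) }
  ; *-comm = ⊛-comm }

series-commutativeRing : CommutativeRing _ _
series-commutativeRing = record { isCommutativeRing = series-isCommutativeRing }

con : ℚ → Series
con c = c · oneS

con-+ : ∀ c d → con (c + d) ≈ (con c ⊕ con d)
con-+ c d = mk λ n → ℚP.*-distribʳ-+ (oneS n) c d

con-neg : ∀ c → con (- c) ≈ negS (con c)
con-neg c = mk λ n → sym (ℚP.neg-distribˡ-* c (oneS n))

con-minus : ∀ c d → con (c - d) ≈ (con c ⊖ con d)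
con-minus c d = ≈-trans (con-+ c (- d)) (⊕-cong (≈-refl {con c}) (con-neg d))

one : Series
one = con 1ℚ

one≈oneS : one ≈ oneS
one≈oneS = mk λ n → ℚP.*-identityˡ (oneS n)

·≈con⊛ : ∀ c f → (c · f) ≈ (con c ⊛ f)
·≈con⊛ c f = ≈-sym (≈-trans (⊛-scalˡ c oneS f) (·-cong c (⊛-identityˡ f)))

con⊛-at : ∀ c f n → (con c ⊛ f) n ≡ c * f n
con⊛-at c f n = sym (at (·≈con⊛ c f) n)

con-* : ∀ c d → con (c * d) ≈ (con c ⊛ con d)
con-* c d = ≈-trans (mk λ n → ℚP.*-assoc c d (oneS n)) (·≈con⊛ c (con d))

series-almostCommutativeRing : ACR.AlmostCommutativeRing _ _
series-almostCommutativeRing = ACR.fromCommutativeRing series-commutativeRing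

con-homomorphism : ℚ.+-*-rawRing ACR.-Raw-AlmostCommutative⟶ series-almostCommutativeRing
con-homomorphism = record
  { ⟦_⟧    = con
  ; +-homo = con-+
  ; *-homo = con-*
  ; -‿homo = con-neg
  ; 0-homo = mk λ n → ℚP.*-zeroˡ (oneS n)
  ; 1-homo = one≈oneS
  }

con-≟ : ∀ c d → Maybe.Maybe (con c ≈ con d)
con-≟ c d = Maybe.map (λ { refl → ≈-refl }) (dec⇒maybe (c ℚP.≟ d))

open import Algebra.Solver.Ring ℚ.+-*-rawRing series-almostCommutativeRing con-homomorphism con-≟
  using (solve; _:=_; _:+_; _:*_; _:-_; :-_) renaming (con to K)
import Relation.Binary.Reasoning.Setoid as SetoidReasoning

module ≈-Reasoning = SetoidReasoning (CommutativeRing.setoid series-commutativeRing)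

poly₁≈ : ∀ a → poly (a ∷ []) ≈ con a
poly₁≈ a = mk λ where
  zero    → sym (ℚP.*-identityʳ a)
  (suc n) → sym (ℚP.*-zeroʳ a)

poly-cons : ∀ a as → poly (a ∷ as) ≈ (con a ⊕ (xS ⊛ poly as))
poly-cons a as = mk λ where
  zero    → sym (trans (cong₂ _+_ (ℚP.*-identityʳ a) (xS⊛-0 (poly as))) (ℚP.+-identityʳ a))
  (suc n) → sym (trans (cong₂ _+_ (ℚP.*-zeroʳ a) (xS⊛-suc (poly as) n)) (ℚP.+-identityˡ (poly as n)))

poly₂≈ : ∀ a b → poly (a ∷ b ∷ []) ≈ (con a ⊕ (con b ⊛ xS))
poly₂≈ a b = begin
  poly (a ∷ b ∷ [])                 ≈⟨ ≈-trans (poly-cons a _) (⊕-cong (≈-refl {con a}) (⊛-congʳ xS (poly₁≈ b))) ⟩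
  con a ⊕ (xS ⊛ con b)              ≈⟨ ⊕-cong (≈-refl {con a}) (⊛-comm xS (con b)) ⟩
  con a ⊕ (con b ⊛ xS)              ∎
  where open ≈-Reasoning

poly₃≈ : ∀ a b c → poly (a ∷ b ∷ c ∷ []) ≈ ((con a ⊕ (con b ⊛ xS)) ⊕ (con c ⊛ (xS ⊛ xS)))
poly₃≈ a b c = begin
  poly (a ∷ b ∷ c ∷ [])                               ≈⟨ ≈-trans (poly-cons a _) (⊕-cong (≈-refl {con a}) (⊛-congʳ xS (poly₂≈ b c))) ⟩
  con a ⊕ (xS ⊛ (con b ⊕ (con c ⊛ xS)))               ≈⟨ horner (con a) (con b) (con c) xS ⟩
  (con a ⊕ (con b ⊛ xS)) ⊕ (con c ⊛ (xS ⊛ xS))        ∎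
  where
  open ≈-Reasoning
  horner : ∀ A B C x → (A ⊕ (x ⊛ (B ⊕ (C ⊛ x)))) ≈ ((A ⊕ (B ⊛ x)) ⊕ (C ⊛ (x ⊛ x)))
  horner = solve 4 (λ A B C x → A :+ (x :* (B :+ (C :* x))) := (A :+ (B :* x)) :+ (C :* (x :* x))) ≈-refl

drop-⊛-zero : ∀ {A B} c {Z} → A ≈ (B ⊕ (c ⊛ Z)) → Z ≈ zeroS → A ≈ B
drop-⊛-zero {B = B} c p Z≈0 = ≈-trans p (mk λ n →
  trans (cong (B n +_) (at (≈-trans (⊛-congʳ c Z≈0) (⊛-zeroʳ c)) n)) (ℚP.+-identityʳ (B n)))

⊖-self≈zero : ∀ {A B} → A ≈ B → (A ⊖ B) ≈ zeroS
⊖-self≈zero {A} {B} A≈B = mk λ n → trans (cong (_- B n) (at A≈B n)) (ℚP.+-inverseʳ (B n))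

if-≟-yes : ∀ {m n} {A : Set} {x y : A} → m ≡ n → (if ⌊ m ℕ.≟ n ⌋ then x else y) ≡ x
if-≟-yes {m} {n} m≡n with m ℕ.≟ n
... | yes _   = refl
... | no m≢n = contradiction m≡n m≢n

if-≟-no : ∀ {m n} {A : Set} {x y : A} → m ≢ n → (if ⌊ m ℕ.≟ n ⌋ then x else y) ≡ y
if-≟-no {m} {n} m≢n with m ℕ.≟ n
... | yes m≡n = contradiction m≡n m≢n
... | no _    = refl

-- Composition of series

Order≥ : ℕ → Series → Set
Order≥ k h = ∀ n → n < k → h n ≡ 0ℚ

⊛-order≥ : ∀ {k h} g → Order≥ k h → Order≥ k (g ⊛ h)
⊛-order≥ {k} {h} g ord n n<k = sumTo-zero (suc n) λ i _ →
  trans (cong (g i *_) (ord (n ∸ i) (ℕP.≤-<-trans (ℕP.m∸n≤m n i) n<k))) (ℚP.*-zeroʳ (g i))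

⊛-order≥-suc : ∀ {k h} G → G 0 ≡ 0ℚ → Order≥ k h → Order≥ (suc k) (G ⊛ h)
⊛-order≥-suc {k} {h} G G0≡0 ord n n<1+k = sumTo-zero (suc n) (term n n<1+k)
  where
  term : ∀ n → n < suc k → ∀ i → i < suc n → G i * h (n ∸ i) ≡ 0ℚ
  term n _ zero _ = trans (cong (_* h n) G0≡0) (ℚP.*-zeroˡ (h n))
  term zero    _ (suc i) (s≤s ())
  term (suc n) (s≤s n<k) (suc i) _ =
    trans (cong (G (suc i) *_) (ord (n ∸ i) (ℕP.≤-<-trans (ℕP.m∸n≤m n i) n<k))) (ℚP.*-zeroʳ (G (suc i)))

^S-order≥ : ∀ {G} → G 0 ≡ 0ℚ → ∀ k → Order≥ k (G ^S k)
^S-order≥ G0≡0 zero    n ()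
^S-order≥ {G} G0≡0 (suc k) = ⊛-order≥-suc G G0≡0 (^S-order≥ G0≡0 k)

⊛-congʳ-≤ : ∀ g {h h'} n → (∀ m → m ≤ n → h m ≡ h' m) → (g ⊛ h) n ≡ (g ⊛ h') n
⊛-congʳ-≤ g n eq = sumTo-cong (suc n) (λ k → cong (g k *_) (eq (n ∸ k) (ℕP.m∸n≤m n k)))

-- Only meaningful when G 0 ≡ 0, which makes the truncation of the sum at j ≤ n harmless.
_∘ˢ_ : Series → Series → Series
(f ∘ˢ G) n = sumTo (suc n) (λ j → f j * (G ^S j) n)

sumTo-⊛-∘ˢ : ∀ c g {G} → G 0 ≡ 0ℚ → ∀ n → sumTo (suc n) (λ j → c j * (g ⊛ (G ^S j)) n) ≡ (g ⊛ (c ∘ˢ G)) n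
sumTo-⊛-∘ˢ c g {G} G0≡0 n =
  trans (sumTo-cong (suc n) (λ j → sym (sumTo-*ˡ (suc n) (c j) _)))
  (trans (sumTo-swap (suc n) (suc n) _)
  (sumTo-cong-< (suc n) λ m m<1+n →
     trans (sumTo-cong (suc n) (λ j → swap (c j) (g m) ((G ^S j) (n ∸ m))))
     (trans (sumTo-*ˡ (suc n) (g m) _)
     (cong (g m *_) (sym (sumTo-extend (suc n) _ (s≤s (ℕP.m∸n≤m n m))
        (λ j n∸m<j _ → trans (cong (c j *_) (^S-order≥ G0≡0 j (n ∸ m) n∸m<j)) (ℚP.*-zeroʳ (c j)))))))))
  where
  swap : ∀ a b d → a * (b * d) ≡ b * (a * d)
  swap = solve-∀ ℚ-ring

⊛-suc-order≥1 : ∀ G → G 0 ≡ 0ℚ → ∀ h n → (G ⊛ h) (suc n) ≡ (divX G ⊛ h) n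
⊛-suc-order≥1 G G0≡0 h n =
  trans (⊛-suc G h n) (trans (cong (_+ (divX G ⊛ h) n) (trans (cong (_* h (suc n)) G0≡0) (ℚP.*-zeroˡ (h (suc n)))))
                             (ℚP.+-identityˡ _))

∘ˢ-0 : ∀ f G → (f ∘ˢ G) 0 ≡ f 0
∘ˢ-0 f G = trans (ℚP.+-identityˡ _) (ℚP.*-identityʳ (f 0))

∘ˢ-suc : ∀ f {G} → G 0 ≡ 0ℚ → ∀ n → (f ∘ˢ G) (suc n) ≡ (divX G ⊛ (divX f ∘ˢ G)) n
∘ˢ-suc f {G} G0≡0 n =
  trans (sumTo-head (suc n) _)
  (trans (cong₂ _+_ (ℚP.*-zeroʳ (f 0)) (sumTo-cong (suc n) (λ j → cong (f (suc j) *_) (⊛-suc-order≥1 G G0≡0 (G ^S j) n))))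
  (trans (ℚP.+-identityˡ _) (sumTo-⊛-∘ˢ (divX f) (divX G) G0≡0 n)))

∘ˢ-unfold : ∀ f {G} → G 0 ≡ 0ℚ → (f ∘ˢ G) ≈ ((f 0 · oneS) ⊕ (G ⊛ (divX f ∘ˢ G)))
∘ˢ-unfold f {G} G0≡0 = mk λ where
  zero    → trans (∘ˢ-0 f G) (sym (trans (cong₂ _+_ (ℚP.*-identityʳ (f 0)) (⊛-order≥-suc {0} {divX f ∘ˢ G} G G0≡0 (λ _ ()) 0 (s≤s z≤n)))
                                        (ℚP.+-identityʳ (f 0))))
  (suc n) → trans (∘ˢ-suc f G0≡0 n)
              (sym (trans (cong₂ _+_ (ℚP.*-zeroʳ (f 0)) (⊛-suc-order≥1 G G0≡0 (divX f ∘ˢ G) n)) (ℚP.+-identityˡ _)))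

∘ˢ-congˡ : ∀ {f f'} G → f ≈ f' → (f ∘ˢ G) ≈ (f' ∘ˢ G)
∘ˢ-congˡ G p = mk λ n → sumTo-cong (suc n) (λ j → cong (_* (G ^S j) n) (at p j))

∘ˢ-⊕ : ∀ f h G → ((f ⊕ h) ∘ˢ G) ≈ ((f ∘ˢ G) ⊕ (h ∘ˢ G))
∘ˢ-⊕ f h G = mk λ n → trans (sumTo-cong (suc n) (λ j → ℚP.*-distribʳ-+ ((G ^S j) n) (f j) (h j))) (sumTo-+ (suc n) _ _)

∘ˢ-· : ∀ c f G → ((c · f) ∘ˢ G) ≈ (c · (f ∘ˢ G))
∘ˢ-· c f G = mk λ n → trans (sumTo-cong (suc n) (λ j → ℚP.*-assoc c (f j) _)) (sumTo-*ˡ (suc n) c _)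

∘ˢ-zeroˡ : ∀ G → (zeroS ∘ˢ G) ≈ zeroS
∘ˢ-zeroˡ G = mk λ n → sumTo-zero (suc n) (λ j _ → ℚP.*-zeroˡ ((G ^S j) n))

∘ˢ-oneS : ∀ {G} → G 0 ≡ 0ℚ → (oneS ∘ˢ G) ≈ oneS
∘ˢ-oneS {G} G0≡0 = ≈-trans (∘ˢ-unfold oneS G0≡0) (mk λ n →
  trans (cong (1ℚ * oneS n +_) (at (≈-trans (⊛-congʳ G (∘ˢ-zeroˡ G)) (⊛-zeroʳ G)) n))
        (trans (ℚP.+-identityʳ _) (ℚP.*-identityˡ (oneS n))))

∘ˢ-xS : ∀ {G} → G 0 ≡ 0ℚ → (xS ∘ˢ G) ≈ G
∘ˢ-xS {G} G0≡0 = ≈-trans (∘ˢ-unfold xS G0≡0) (mk λ n →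
  trans (cong₂ _+_ (ℚP.*-zeroˡ (oneS n)) (at (≈-trans (⊛-congʳ G (∘ˢ-oneS G0≡0)) (⊛-identityʳ G)) n))
        (ℚP.+-identityˡ (G n)))

∘ˢ-⊛-≤ : ∀ f h {G} → G 0 ≡ 0ℚ → ∀ n m → m ≤ n → ((f ⊛ h) ∘ˢ G) m ≡ ((f ∘ˢ G) ⊛ (h ∘ˢ G)) m
∘ˢ-⊛-≤ f h {G} G0≡0 zero .zero z≤n =
  trans (∘ˢ-0 (f ⊛ h) G) (trans (⊛-0 f h) (sym (trans (⊛-0 (f ∘ˢ G) (h ∘ˢ G)) (cong₂ _*_ (∘ˢ-0 f G) (∘ˢ-0 h G)))))
∘ˢ-⊛-≤ f h {G} G0≡0 (suc n) m m≤1+n with ℕP.m≤n⇒m<n∨m≡n m≤1+n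
... | inj₁ (s≤s m≤n) = ∘ˢ-⊛-≤ f h G0≡0 n m m≤n
... | inj₂ refl = begin
    ((f ⊛ h) ∘ˢ G) (suc n)
      ≡⟨ ∘ˢ-suc (f ⊛ h) G0≡0 n ⟩
    (G' ⊛ (divX (f ⊛ h) ∘ˢ G)) n
      ≡⟨ at (⊛-congʳ G' (≈-trans (∘ˢ-congˡ G (divX-⊛ f h)) (∘ˢ-⊕ (f 0 · h') (f' ⊛ h) G))) n ⟩
    (G' ⊛ (((f 0 · h') ∘ˢ G) ⊕ ((f' ⊛ h) ∘ˢ G))) n
      ≡⟨ ⊛-congʳ-≤ G' n (λ k k≤n → cong₂ _+_ (at (∘ˢ-· (f 0) h' G) k) (∘ˢ-⊛-≤ f' h {G} G0≡0 n k k≤n)) ⟩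
    (G' ⊛ ((f 0 · ch') ⊕ (cf' ⊛ ch))) n
      ≡⟨ at (⊛-distribˡ G' (f 0 · ch') (cf' ⊛ ch)) n ⟩
    (G' ⊛ (f 0 · ch')) n + (G' ⊛ (cf' ⊛ ch)) n
      ≡⟨ cong₂ _+_ (at (⊛-scalʳ (f 0) G' ch') n) (sym (⊛-suc-order≥1 G G0≡0 (cf' ⊛ ch) n)) ⟩
    f 0 * (G' ⊛ ch') n + (G ⊛ (cf' ⊛ ch)) (suc n)
      ≡⟨ cong₂ _+_ (cong (f 0 *_) (sym (∘ˢ-suc h G0≡0 n))) (sym (⊛-assoc-at G cf' ch (suc n))) ⟩
    f 0 * ch (suc n) + ((G ⊛ cf') ⊛ ch) (suc n)
      ≡⟨ cong (_+ ((G ⊛ cf') ⊛ ch) (suc n)) (sym (trans (at (⊛-scalˡ (f 0) oneS ch) (suc n)) (cong (f 0 *_) (⊛-identityˡ-at ch (suc n))))) ⟩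
    ((f 0 · oneS) ⊛ ch) (suc n) + ((G ⊛ cf') ⊛ ch) (suc n)
      ≡⟨ sym (at (≈-trans (⊛-congˡ ch (∘ˢ-unfold f G0≡0)) (⊛-distribʳ (f 0 · oneS) (G ⊛ cf') ch)) (suc n)) ⟩
    ((f ∘ˢ G) ⊛ (h ∘ˢ G)) (suc n) ∎
  where
  open ≡-Reasoning
  G' f' h' cf' ch ch' : Series
  G'  = divX G
  f'  = divX f
  h'  = divX h
  cf' = f' ∘ˢ G
  ch  = h ∘ˢ G
  ch' = h' ∘ˢ G

∘ˢ-⊛ : ∀ f h {G} → G 0 ≡ 0ℚ → ((f ⊛ h) ∘ˢ G) ≈ ((f ∘ˢ G) ⊛ (h ∘ˢ G))
∘ˢ-⊛ f h G0≡0 = mk λ n → ∘ˢ-⊛-≤ f h G0≡0 n n ℕP.≤-refl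

∘ˢ-^S : ∀ f {G} → G 0 ≡ 0ℚ → ∀ k → ((f ^S k) ∘ˢ G) ≈ ((f ∘ˢ G) ^S k)
∘ˢ-^S f G0≡0 zero    = ∘ˢ-oneS G0≡0
∘ˢ-^S f {G} G0≡0 (suc k) = ≈-trans (∘ˢ-⊛ f (f ^S k) G0≡0) (⊛-congʳ (f ∘ˢ G) (∘ˢ-^S f G0≡0 k))

∘ˢ-con : ∀ c {G} → G 0 ≡ 0ℚ → (con c ∘ˢ G) ≈ con c
∘ˢ-con c G0≡0 = ≈-trans (∘ˢ-· c oneS _) (·-cong c (∘ˢ-oneS G0≡0))

∘ˢ-con⊛xS : ∀ c {G} → G 0 ≡ 0ℚ → ((con c ⊛ xS) ∘ˢ G) ≈ (con c ⊛ G)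
∘ˢ-con⊛xS c {G} G0≡0 =
  ≈-trans (∘ˢ-congˡ G (≈-sym (·≈con⊛ c xS))) (≈-trans (∘ˢ-· c xS G) (≈-trans (·-cong c (∘ˢ-xS G0≡0)) (·≈con⊛ c G)))

∘ˢ-affine : ∀ a b {G} → G 0 ≡ 0ℚ → ((con a ⊕ (con b ⊛ xS)) ∘ˢ G) ≈ (con a ⊕ (con b ⊛ G))
∘ˢ-affine a b {G} G0≡0 = ≈-trans (∘ˢ-⊕ (con a) (con b ⊛ xS) G) (⊕-cong (∘ˢ-con a G0≡0) (∘ˢ-con⊛xS b G0≡0))

∘ˢ-poly₂ : ∀ a b {G} → G 0 ≡ 0ℚ → (poly (a ∷ b ∷ []) ∘ˢ G) ≈ (con a ⊕ (con b ⊛ G))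
∘ˢ-poly₂ a b {G} G0≡0 = ≈-trans (∘ˢ-congˡ G (poly₂≈ a b)) (∘ˢ-affine a b G0≡0)

∘ˢ-poly₃ : ∀ a b c {G} → G 0 ≡ 0ℚ → (poly (a ∷ b ∷ c ∷ []) ∘ˢ G) ≈ ((con a ⊕ (con b ⊛ G)) ⊕ (con c ⊛ (G ⊛ G)))
∘ˢ-poly₃ a b c {G} G0≡0 = begin
  poly (a ∷ b ∷ c ∷ []) ∘ˢ G
    ≈⟨ ≈-trans (∘ˢ-congˡ G (poly₃≈ a b c)) (∘ˢ-⊕ (con a ⊕ (con b ⊛ xS)) (con c ⊛ (xS ⊛ xS)) G) ⟩
  ((con a ⊕ (con b ⊛ xS)) ∘ˢ G) ⊕ ((con c ⊛ (xS ⊛ xS)) ∘ˢ G)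
    ≈⟨ ⊕-cong (∘ˢ-affine a b G0≡0) (∘ˢ-⊛ (con c) (xS ⊛ xS) G0≡0) ⟩
  (con a ⊕ (con b ⊛ G)) ⊕ ((con c ∘ˢ G) ⊛ ((xS ⊛ xS) ∘ˢ G))
    ≈⟨ ⊕-cong (≈-refl {con a ⊕ (con b ⊛ G)}) (⊛-cong (∘ˢ-con c G0≡0) x²∘G) ⟩
  (con a ⊕ (con b ⊛ G)) ⊕ (con c ⊛ (G ⊛ G))                   ∎
  where
  open ≈-Reasoning
  x²∘G : ((xS ⊛ xS) ∘ˢ G) ≈ (G ⊛ G)
  x²∘G = ≈-trans (∘ˢ-⊛ xS xS G0≡0) (⊛-cong (∘ˢ-xS G0≡0) (∘ˢ-xS G0≡0))

-- Inverse and square root of a series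

-- `cov` is defined through a private table of all earlier values; the field
-- `table` is that table, recovered by unification from the unfolding of `cov`.
record CovUnfolding (b : ℚ) (s : ℕ → (ℕ → ℚ) → ℚ) : Set where
  field
    table     : ℕ → ℕ → ℚ
    cov-suc   : ∀ n → cov b s (suc n) ≡ s n (table n)
    table-suc : ∀ n i → table (suc n) i ≡ (if ⌊ i ℕ.≟ suc n ⌋ then s n (table n) else table n i)
    cov-diag  : ∀ n → cov b s n ≡ table n n

  table-agrees : ∀ n i → i ≤ n → table n i ≡ cov b s i
  table-agrees zero    .zero z≤n = sym (cov-diag 0)
  table-agrees (suc n) i i≤1+n with ℕP.m≤n⇒m<n∨m≡n i≤1+n
  ... | inj₂ refl      = sym (cov-diag (suc n))
  ... | inj₁ (s≤s i≤n) =
    trans (table-suc n i) (trans (if-≟-no (ℕP.<⇒≢ (s≤s i≤n))) (table-agrees n i i≤n))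

covUnfolding : ∀ b s → CovUnfolding b s
covUnfolding b s = record
  { table     = _
  ; cov-suc   = λ n → if-≟-yes {suc n} refl
  ; table-suc = λ n i → refl
  ; cov-diag  = λ n → refl
  }

invS-suc : ∀ a n → invS a (suc n) ≡ - (recip (a 0) * (divX a ⊛ invS a) n)
invS-suc a n = trans (cov-suc n) (cong (λ z → - (recip (a 0) * z))
  (sumTo-cong (suc n) (λ k → cong (a (suc k) *_) (table-agrees n (n ∸ k) (ℕP.m∸n≤m n k)))))
  where open CovUnfolding (covUnfolding _ _)

⊛-invS : ∀ a → a 0 ≢ 0ℚ → (a ⊛ invS a) ≈ oneS
⊛-invS a a0≢0 = mk coeff
  where
  cancel : ∀ x y z → x * y ≡ 1ℚ → x * (- (y * z)) + z ≡ 0ℚ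
  cancel x y z xy≡1 = trans (regroup x y z) (trans (cong (λ w → - (w * z) + z) xy≡1) (annihilate z))
    where
    regroup : ∀ x y z → x * (- (y * z)) + z ≡ - ((x * y) * z) + z
    regroup = solve-∀ ℚ-ring
    annihilate : ∀ z → - (1ℚ * z) + z ≡ 0ℚ
    annihilate = solve-∀ ℚ-ring
  coeff : ∀ n → (a ⊛ invS a) n ≡ oneS n
  coeff zero    = trans (⊛-0 a (invS a)) (recip-inverseʳ (a 0) a0≢0)
  coeff (suc n) = trans (⊛-suc a (invS a) n)
    (trans (cong (λ z → a 0 * z + (divX a ⊛ invS a) n) (invS-suc a n))
    (cancel (a 0) (recip (a 0)) ((divX a ⊛ invS a) n) (recip-inverseʳ (a 0) a0≢0)))

sqrtS-suc : ∀ a n → sqrtS a (suc n) ≡ ½ * (a (suc n) - sumTo n (λ k → sqrtS a (suc k) * sqrtS a (n ∸ k)))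
sqrtS-suc a n = trans (cov-suc n) (cong (λ z → ½ * (a (suc n) - z))
  (sumTo-cong-< n (λ k k<n → cong₂ _*_ (table-agrees n (suc k) k<n) (table-agrees n (n ∸ k) (ℕP.m∸n≤m n k)))))
  where open CovUnfolding (covUnfolding _ _)

sqrtS-square : ∀ a → a 0 ≡ 1ℚ → (sqrtS a ⊛ sqrtS a) ≈ a
sqrtS-square a a0≡1 = mk coeff
  where
  s : Series
  s = sqrtS a
  mixed : ℕ → ℚ
  mixed n = sumTo n (λ k → s (suc k) * s (n ∸ k))
  halves : ∀ A y → 1ℚ * (½ * (A - y)) + (y + (½ * (A - y)) * 1ℚ) ≡ A
  -- ½ + ½ computes to 1ℚ, so the two identities compose.
  halves A y = trans (regroup ½ A y) (restore A y)
    where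
    regroup : ∀ h A y → 1ℚ * (h * (A - y)) + (y + (h * (A - y)) * 1ℚ) ≡ (h + h) * (A - y) + y
    regroup = solve-∀ ℚ-ring
    restore : ∀ A y → 1ℚ * (A - y) + y ≡ A
    restore = solve-∀ ℚ-ring
  coeff : ∀ n → (s ⊛ s) n ≡ a n
  coeff zero    = trans (⊛-0 s s) (trans (ℚP.*-identityˡ 1ℚ) (sym a0≡1))
  coeff (suc n) = trans (⊛-suc s s n)
    (trans (cong (λ z → 1ℚ * s (suc n) + (mixed n + s (suc n) * s z)) (ℕP.n∸n≡0 n))
    (trans (cong (λ z → 1ℚ * z + (mixed n + z * 1ℚ)) (sqrtS-suc a n))
    (halves (a (suc n)) (mixed n))))

∘ˢ-⊛-invS : ∀ f a {G} → a 0 ≢ 0ℚ → G 0 ≡ 0ℚ → ((f ⊛ (a ∘ˢ G)) ⊛ (invS a ∘ˢ G)) ≈ f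
∘ˢ-⊛-invS f a {G} a0≢0 G0≡0 = begin
  (f ⊛ (a ∘ˢ G)) ⊛ (invS a ∘ˢ G)   ≈⟨ ⊛-assoc f (a ∘ˢ G) (invS a ∘ˢ G) ⟩
  f ⊛ ((a ∘ˢ G) ⊛ (invS a ∘ˢ G))   ≈⟨ ⊛-congʳ f (≈-sym (∘ˢ-⊛ a (invS a) G0≡0)) ⟩
  f ⊛ ((a ⊛ invS a) ∘ˢ G)          ≈⟨ ⊛-congʳ f (≈-trans (∘ˢ-congˡ G (⊛-invS a a0≢0)) (∘ˢ-oneS G0≡0)) ⟩
  f ⊛ oneS                         ≈⟨ ⊛-identityʳ f ⟩
  f                                ∎
  where open ≈-Reasoning

-- Lower triangular matrices and Riordan arrays

LowerTriangular : Matrix → Set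
LowerTriangular M = ∀ n k → n < k → M n k ≡ 0ℚ

diag-≡ : ∀ d n → diag d n n ≡ d n
diag-≡ d n = if-≟-yes {n} refl

diag-≢ : ∀ d n k → n ≢ k → diag d n k ≡ 0ℚ
diag-≢ d n k = if-≟-no {n} {k}

I-≡ : ∀ n → I n n ≡ 1ℚ
I-≡ = diag-≡ (λ _ → 1ℚ)

I-≢ : ∀ n k → n ≢ k → I n k ≡ 0ℚ
I-≢ = diag-≢ (λ _ → 1ℚ)

≐-sym : ∀ {M N} → M ≐ N → N ≐ M
≐-sym p n k = sym (p n k)

≐-trans : ∀ {M N P} → M ≐ N → N ≐ P → M ≐ P
≐-trans p q n k = trans (p n k) (q n k)

⊙-congˡ : ∀ {M M'} N → M ≐ M' → (M ⊙ N) ≐ (M' ⊙ N)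
⊙-congˡ N p n k = sumTo-cong (suc n) (λ j → cong (_* N j k) (p n j))

⊙-assoc : ∀ A B C → LowerTriangular B → (A ⊙ (B ⊙ C)) ≐ ((A ⊙ B) ⊙ C)
⊙-assoc A B C B-lower n k =
  trans (sumTo-cong-< (suc n) (λ j j<1+n → trans (sym (sumTo-*ˡ (suc j) (A n j) (λ i → B j i * C i k)))
          (sumTo-extend (suc n) _ j<1+n (λ i j<i _ →
             trans (cong (λ z → A n j * (z * C i k)) (B-lower j i j<i))
                   (trans (cong (A n j *_) (ℚP.*-zeroˡ (C i k))) (ℚP.*-zeroʳ (A n j)))))))
  (trans (sumTo-swap (suc n) (suc n) (λ j i → A n j * (B j i * C i k)))
  (sumTo-cong (suc n) (λ i → trans (sumTo-cong (suc n) (λ j → sym (ℚP.*-assoc (A n j) (B j i) (C i k))))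
                                   (sumTo-*ʳ (suc n) (C i k) (λ j → A n j * B j i)))))

⊙-identityˡ : ∀ A → (I ⊙ A) ≐ A
⊙-identityˡ A n k =
  trans (sumTo-single (suc n) (λ j → I n j * A j k) n ℕP.≤-refl
          (λ j _ j≢n → trans (cong (_* A j k) (I-≢ n j (≢-sym j≢n))) (ℚP.*-zeroˡ (A j k))))
        (trans (cong (_* A n k) (I-≡ n)) (ℚP.*-identityˡ (A n k)))

⊙-identityʳ : ∀ A → LowerTriangular A → (A ⊙ I) ≐ A
⊙-identityʳ A A-lower n k with ℕP.<-cmp k (suc n)
... | tri< k<1+n _ _ =
  trans (sumTo-single (suc n) (λ j → A n j * I j k) k k<1+n
           (λ j _ j≢k → trans (cong (A n j *_) (I-≢ j k j≢k)) (ℚP.*-zeroʳ (A n j))))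
        (trans (cong (A n k *_) (I-≡ k)) (ℚP.*-identityʳ (A n k)))
... | tri≈ _ refl _ =
  trans (sumTo-zero (suc n) (λ j j<1+n → trans (cong (A n j *_) (I-≢ j k (ℕP.<⇒≢ j<1+n))) (ℚP.*-zeroʳ (A n j))))
        (sym (A-lower n k ℕP.≤-refl))
... | tri> _ _ 1+n<k =
  trans (sumTo-zero (suc n) (λ j j<1+n → trans (cong (A n j *_) (I-≢ j k (ℕP.<⇒≢ (ℕP.<-trans j<1+n 1+n<k)))) (ℚP.*-zeroʳ (A n j))))
        (sym (A-lower n k (ℕP.<-trans ℕP.≤-refl 1+n<k)))

⊙-diagonal : ∀ A B → LowerTriangular B → ∀ n → (A ⊙ B) n n ≡ A n n * B n n
⊙-diagonal A B B-lower n =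
  trans (cong (_+ A n n * B n n) (sumTo-zero n (λ j j<n → trans (cong (A n j *_) (B-lower j n j<n)) (ℚP.*-zeroʳ (A n j)))))
        (ℚP.+-identityˡ _)

-- Forward substitution: row m of X is determined by A ⊙ X and the rows above it.
⊙-cancelˡ : ∀ A X Y → (∀ n → A n n ≢ 0ℚ) → (A ⊙ X) ≐ (A ⊙ Y) → X ≐ Y
⊙-cancelˡ A X Y A-diag AX≐AY m k = rows (suc m) m ℕP.≤-refl k
  where
  rows : ∀ N m → m < N → ∀ k → X m k ≡ Y m k
  rows (suc N) m m<1+N k = *-cancelˡ-≢0 (A m m) (A-diag m) (+-cancelˡ (sumTo m (λ j → A m j * X j k)) _ _
    (trans (AX≐AY m k) (cong (_+ A m m * Y m k) (sym (sumTo-cong-< m (λ j j<m →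
      cong (A m j *_) (rows N j (ℕP.<-≤-trans j<m (ℕP.≤-pred m<1+N)) k)))))))

⊙-inverse-comm : ∀ A B → LowerTriangular A → LowerTriangular B → (A ⊙ B) ≐ I → (B ⊙ A) ≐ I
⊙-inverse-comm A B A-lower B-lower AB≐I = ⊙-cancelˡ A (B ⊙ A) I A-diag
  (≐-trans (⊙-assoc A B A B-lower) (≐-trans (⊙-congˡ A AB≐I) (≐-trans (⊙-identityˡ A) (≐-sym (⊙-identityʳ A A-lower)))))
  where
  A-diag : ∀ n → A n n ≢ 0ℚ
  A-diag n Ann≡0 with trans (sym (I-≡ n)) (trans (sym (AB≐I n n)) (trans (⊙-diagonal A B B-lower n)
                        (trans (cong (_* B n n) Ann≡0) (ℚP.*-zeroˡ (B n n)))))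
  ... | ()

Riordan-lowerTriangular : ∀ g {F} → F 0 ≡ 0ℚ → LowerTriangular (Riordan g F)
Riordan-lowerTriangular g F0≡0 n k = ⊛-order≥ g (^S-order≥ F0≡0 k) n

-- The fundamental theorem of Riordan arrays: (g, F) acts on a column c as c ↦ g · c(F).
Riordan-⊙ : ∀ g {F} M → F 0 ≡ 0ℚ → ∀ n k → (Riordan g F ⊙ M) n k ≡ (g ⊛ ((λ j → M j k) ∘ˢ F)) n
Riordan-⊙ g {F} M F0≡0 n k =
  trans (sumTo-cong (suc n) (λ j → ℚP.*-comm _ (M j k))) (sumTo-⊛-∘ˢ (λ j → M j k) g F0≡0 n)

xS^S-at : ∀ k n → (xS ^S k) n ≡ I n k
xS^S-at zero    zero    = refl
xS^S-at zero    (suc n) = refl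
xS^S-at (suc k) zero    = xS⊛-0 (xS ^S k)
xS^S-at (suc k) (suc n) with n ℕ.≟ k
... | yes refl = trans (xS⊛-suc (xS ^S k) n) (trans (xS^S-at k n) (trans (I-≡ n) (sym (I-≡ (suc n)))))
... | no n≢k   = trans (xS⊛-suc (xS ^S k) n)
  (trans (xS^S-at k n) (trans (I-≢ n k n≢k) (sym (I-≢ (suc n) (suc k) (λ e → n≢k (ℕP.suc-injective e))))))

·xS-^S : ∀ a k → ((a · xS) ^S k) ≈ ((a ^ℚ k) · (xS ^S k))
·xS-^S a zero    = mk λ n → sym (ℚP.*-identityˡ (oneS n))
·xS-^S a (suc k) = ≈-trans (⊛-congʳ (a · xS) (·xS-^S a k))
  (≈-trans (⊛-scalˡ a xS ((a ^ℚ k) · (xS ^S k)))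
  (≈-trans (·-cong a (⊛-scalʳ (a ^ℚ k) xS (xS ^S k)))
  (mk λ n → sym (ℚP.*-assoc a (a ^ℚ k) _))))

Riordan-inverse : ∀ g {F} h l → F 0 ≡ 0ℚ → (g ⊛ (h ∘ˢ F)) ≈ oneS → (l ∘ˢ F) ≈ xS → (Riordan g F ⊙ Riordan h l) ≐ I
Riordan-inverse g {F} h l F0≡0 g·h∘F≈1 l∘F≈x n k =
  trans (Riordan-⊙ g (Riordan h l) F0≡0 n k) (trans (at column n) (xS^S-at k n))
  where
  open ≈-Reasoning
  column : (g ⊛ ((h ⊛ (l ^S k)) ∘ˢ F)) ≈ (xS ^S k)
  column = begin
    g ⊛ ((h ⊛ (l ^S k)) ∘ˢ F)          ≈⟨ ⊛-congʳ g (∘ˢ-⊛ h (l ^S k) F0≡0) ⟩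
    g ⊛ ((h ∘ˢ F) ⊛ ((l ^S k) ∘ˢ F))   ≈⟨ ⊛-congʳ g (⊛-congʳ (h ∘ˢ F) (≈-trans (∘ˢ-^S l F0≡0 k) (^S-cong k l∘F≈x))) ⟩
    g ⊛ ((h ∘ˢ F) ⊛ (xS ^S k))         ≈⟨ ≈-sym (⊛-assoc g (h ∘ˢ F) (xS ^S k)) ⟩
    (g ⊛ (h ∘ˢ F)) ⊛ (xS ^S k)         ≈⟨ ≈-trans (⊛-congˡ (xS ^S k) g·h∘F≈1) (⊛-identityˡ (xS ^S k)) ⟩
    xS ^S k                            ∎

-- Binomial coefficients

B-vanish : ∀ {n k} → n < k → B n k ≡ 0ℚ
B-vanish n<k = cong ιℕ (k>n⇒nCk≡0 n<k)

B-pascal : ∀ n k → B (suc n) (suc k) ≡ B n k + B n (suc k)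
B-pascal n k = trans (cong ιℕ (sym (nCk+nC[k+1]≡[n+1]C[k+1] n k))) (ιℕ-+ (n C k) (n C suc k))

B-sym : ∀ {n j} → j ≤ n → B n (n ∸ j) ≡ B n j
B-sym j≤n = cong ιℕ (sym (nCk≡nC[n∸k] j≤n))

B-hockeyStick : ∀ j k → sumTo (suc j) (λ i → B i k) ≡ B (suc j) (suc k)
B-hockeyStick zero    zero    = ℚP.+-identityˡ 1ℚ
B-hockeyStick zero    (suc k) =
  trans (ℚP.+-identityˡ (B 0 (suc k))) (trans (B-vanish {0} {suc k} (s≤s z≤n)) (sym (B-vanish {1} {suc (suc k)} (s≤s (s≤s z≤n)))))
B-hockeyStick (suc j) k =
  trans (cong (_+ B (suc j) k) (B-hockeyStick j k))
        (trans (ℚP.+-comm (B (suc j) (suc k)) (B (suc j) k)) (sym (B-pascal (suc j) k)))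

poly₂⊛-suc : ∀ a b f i → (poly (a ∷ b ∷ []) ⊛ f) (suc i) ≡ a * f (suc i) + b * f i
poly₂⊛-suc a b f i =
  trans (⊛-suc (poly (a ∷ b ∷ [])) f i) (cong (a * f (suc i) +_) (trans (at (⊛-congˡ f (poly₁≈ b)) i) (con⊛-at b f i)))

binomial-coeff : ∀ a n i → (poly (1ℚ ∷ a ∷ []) ^S n) i ≡ B n i * a ^ℚ i
binomial-coeff a zero    zero    = refl
binomial-coeff a zero    (suc i) = sym (ℚP.*-zeroˡ (a ^ℚ suc i))
binomial-coeff a (suc n) zero    = trans (⊛-0 (poly (1ℚ ∷ a ∷ [])) (poly (1ℚ ∷ a ∷ []) ^S n)) (cong (1ℚ *_) (binomial-coeff a n 0))
binomial-coeff a (suc n) (suc i) =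
  trans (poly₂⊛-suc 1ℚ a (poly (1ℚ ∷ a ∷ []) ^S n) i)
  (trans (cong₂ (λ x y → 1ℚ * x + a * y) (binomial-coeff a n (suc i)) (binomial-coeff a n i))
  (trans (collect a (a ^ℚ i) (B n (suc i)) (B n i)) (cong (_* (a * a ^ℚ i)) (sym (B-pascal n i)))))
  where
  collect : ∀ a P x y → 1ℚ * (x * (a * P)) + a * (y * P) ≡ (y + x) * (a * P)
  collect = solve-∀ ℚ-ring

1^ℚ : ∀ i → 1ℚ ^ℚ i ≡ 1ℚ
1^ℚ zero    = refl
1^ℚ (suc i) = trans (ℚP.*-identityˡ _) (1^ℚ i)

binomial-coeff₁ : ∀ n i → (poly (1ℚ ∷ 1ℚ ∷ []) ^S n) i ≡ B n i
binomial-coeff₁ n i = trans (binomial-coeff 1ℚ n i) (trans (cong (B n i *_) (1^ℚ i)) (ℚP.*-identityʳ (B n i)))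

-- The series G and the array A_P(r) = (1, G)

module _ (r : ℤ) where

  ρ : ℚ
  ρ = ι r

  R : Series
  R = con ρ

  Δ-form : Series
  Δ-form = (one ⊕ (negS (con (ιℕ 2) ⊛ (R ⊕ one)) ⊛ xS)) ⊕ (((R ⊖ one) ⊛ (R ⊖ one)) ⊛ (xS ⊛ xS))

  Δ≈ : Δ r ≈ Δ-form
  Δ≈ = ≈-trans (poly₃≈ 1ℚ (- (ιℕ 2 * (ρ + 1ℚ))) ((ρ - 1ℚ) * (ρ - 1ℚ)))
    (⊕-cong (⊕-cong (≈-refl {one})
              (⊛-congˡ xS (≈-trans (con-neg (ιℕ 2 * (ρ + 1ℚ))) (negS-cong (≈-trans (con-* (ιℕ 2) (ρ + 1ℚ)) (⊛-congʳ (con (ιℕ 2)) (con-+ ρ 1ℚ)))))))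
            (⊛-congˡ (xS ⊛ xS) (≈-trans (con-* (ρ - 1ℚ) (ρ - 1ℚ)) (⊛-cong (con-minus ρ 1ℚ) (con-minus ρ 1ℚ)))))

  sqrtΔ²-Δ≈0 : ((sqrtΔ r ⊛ sqrtΔ r) ⊖ Δ-form) ≈ zeroS
  sqrtΔ²-Δ≈0 = ⊖-self≈zero (≈-trans (sqrtS-square (Δ r) refl) Δ≈)

  Gii≈ : Gii r ≈ (con ½ ⊛ ((one ⊕ ((R ⊖ one) ⊛ xS)) ⊖ sqrtΔ r))
  Gii≈ = ≈-trans (·≈con⊛ ½ (poly (1ℚ ∷ (ρ - 1ℚ) ∷ []) ⊖ sqrtΔ r)) (⊛-congʳ (con ½) (⊖-cong
    (≈-trans (poly₂≈ 1ℚ (ρ - 1ℚ)) (⊕-cong (≈-refl {one}) (⊛-congˡ xS (con-minus ρ 1ℚ)))) (≈-refl {sqrtΔ r})))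

  Gii-0 : Gii r 0 ≡ 0ℚ
  Gii-0 = refl

  -- The two sides differ by -¼ (sqrtΔ² - Δ).
  Gii-equation : (Gii r ⊛ (one ⊖ Gii r)) ≈ (xS ⊛ (R ⊖ ((R ⊖ one) ⊛ Gii r)))
  Gii-equation = begin
    G ⊛ (one ⊖ G)                             ≈⟨ ⊛-cong Gii≈ (⊖-cong (≈-refl {one}) Gii≈) ⟩
    G' ⊛ (one ⊖ G')                           ≈⟨ drop-⊛-zero (con (- (½ * ½))) (identity (sqrtΔ r) xS R) sqrtΔ²-Δ≈0 ⟩
    xS ⊛ (R ⊖ ((R ⊖ one) ⊛ G'))               ≈⟨ ⊛-congʳ xS (⊖-cong (≈-refl {R}) (⊛-congʳ (R ⊖ one) (≈-sym Gii≈))) ⟩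
    xS ⊛ (R ⊖ ((R ⊖ one) ⊛ G))                ∎
    where
    open ≈-Reasoning
    G G' : Series
    G  = Gii r
    G' = con ½ ⊛ ((one ⊕ ((R ⊖ one) ⊛ xS)) ⊖ sqrtΔ r)
    identity : ∀ s x ρ → let g = con ½ ⊛ ((con 1ℚ ⊕ ((ρ ⊖ con 1ℚ) ⊛ x)) ⊖ s) in
      (g ⊛ (con 1ℚ ⊖ g)) ≈ ((x ⊛ (ρ ⊖ ((ρ ⊖ con 1ℚ) ⊛ g))) ⊕
        (con (- (½ * ½)) ⊛ ((s ⊛ s) ⊖ ((con 1ℚ ⊕ (negS (con (ιℕ 2) ⊛ (ρ ⊕ con 1ℚ)) ⊛ x)) ⊕ (((ρ ⊖ con 1ℚ) ⊛ (ρ ⊖ con 1ℚ)) ⊛ (x ⊛ x))))))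
    identity = solve 3 (λ s x ρ →
      let g = K ½ :* ((K 1ℚ :+ ((ρ :- K 1ℚ) :* x)) :- s) in
      (g :* (K 1ℚ :- g)) := ((x :* (ρ :- ((ρ :- K 1ℚ) :* g))) :+
        (K (- (½ * ½)) :* ((s :* s) :- ((K 1ℚ :+ ((:- (K (ιℕ 2) :* (ρ :+ K 1ℚ))) :* x)) :+ (((ρ :- K 1ℚ) :* (ρ :- K 1ℚ)) :* (x :* x))))))) ≈-refl

  Fii∘Gii≈xS : r ≢ ℤ.+ 0 → (Fii r ∘ˢ Gii r) ≈ xS
  Fii∘Gii≈xS r≢0 = begin
    Fii r ∘ˢ G                               ≈⟨ ∘ˢ-⊛ (xS ⊛ 1-x) (invS den) Gii-0 ⟩
    ((xS ⊛ 1-x) ∘ˢ G) ⊛ (invS den ∘ˢ G)      ≈⟨ ⊛-congˡ (invS den ∘ˢ G) G[1-G] ⟩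
    (G ⊛ (one ⊖ G)) ⊛ (invS den ∘ˢ G)        ≈⟨ ⊛-congˡ (invS den ∘ˢ G) (≈-trans Gii-equation (⊛-congʳ xS (≈-sym den∘G))) ⟩
    (xS ⊛ (den ∘ˢ G)) ⊛ (invS den ∘ˢ G)      ≈⟨ ∘ˢ-⊛-invS xS den (ι≢0 r r≢0) Gii-0 ⟩
    xS                                       ∎
    where
    open ≈-Reasoning
    G 1-x den : Series
    G   = Gii r
    1-x = poly (1ℚ ∷ (- 1ℚ) ∷ [])
    den = poly (ρ ∷ (- (ρ - 1ℚ)) ∷ [])
    -con⊛ : ∀ c f → (con (- c) ⊛ f) ≈ negS (con c ⊛ f)
    -con⊛ c f = ≈-trans (⊛-congˡ f (con-neg c)) (⊛-negˡ (con c) f)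
    G[1-G] : ((xS ⊛ 1-x) ∘ˢ G) ≈ (G ⊛ (one ⊖ G))
    G[1-G] = ≈-trans (∘ˢ-⊛ xS 1-x Gii-0) (⊛-cong (∘ˢ-xS Gii-0)
      (≈-trans (∘ˢ-poly₂ 1ℚ (- 1ℚ) Gii-0) (⊕-cong (≈-refl {one})
        (≈-trans (-con⊛ 1ℚ G) (negS-cong (≈-trans (⊛-congˡ G one≈oneS) (⊛-identityˡ G)))))))
    den∘G : (den ∘ˢ G) ≈ (R ⊖ ((R ⊖ one) ⊛ G))
    den∘G = ≈-trans (∘ˢ-poly₂ ρ (- (ρ - 1ℚ)) Gii-0) (⊕-cong (≈-refl {R})
      (≈-trans (-con⊛ (ρ - 1ℚ) G) (negS-cong (⊛-congˡ G (con-minus ρ 1ℚ)))))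

  RG : Matrix
  RG = Riordan oneS (Gii r)

  RG-at : ∀ n k → RG n k ≡ (Gii r ^S k) n
  RG-at n k = ⊛-identityˡ-at (Gii r ^S k) n

  RG-lowerTriangular : LowerTriangular RG
  RG-lowerTriangular = Riordan-lowerTriangular oneS Gii-0

  RG-column-recurrence : ∀ n j → RG (suc n) (suc j) ≡ RG (suc n) (suc (suc j)) + (ρ * RG n j - (ρ - 1ℚ) * RG n (suc j))
  RG-column-recurrence n j =
    trans (RG-at (suc n) (suc j))
    (trans (a-b≡c⇒a≡b+c (trans (at series-form (suc n)) (xS⊛-suc ((R ⊛ Gʲ) ⊖ ((R ⊖ one) ⊛ (G ⊛ Gʲ))) n)))
    (cong₂ _+_ (sym (RG-at (suc n) (suc (suc j))))
               (cong₂ _-_ (trans (con⊛-at ρ Gʲ n) (cong (ρ *_) (sym (RG-at n j))))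
                          (trans (at (⊛-congˡ (G ⊛ Gʲ) (≈-sym (con-minus ρ 1ℚ))) n)
                          (trans (con⊛-at (ρ - 1ℚ) (G ⊛ Gʲ) n) (cong ((ρ - 1ℚ) *_) (sym (RG-at n (suc j)))))))))
    where
    open ≈-Reasoning
    G Gʲ : Series
    G  = Gii r
    Gʲ = G ^S j
    split : ∀ a b → a ≡ b + (a - b)
    split = solve-∀ ℚ-ring
    a-b≡c⇒a≡b+c : ∀ {a b c} → a - b ≡ c → a ≡ b + c
    a-b≡c⇒a≡b+c {a} {b} refl = split a b
    series-form : ((G ⊛ Gʲ) ⊖ (G ⊛ (G ⊛ Gʲ))) ≈ (xS ⊛ ((R ⊛ Gʲ) ⊖ ((R ⊖ one) ⊛ (G ⊛ Gʲ))))
    series-form = begin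
      (G ⊛ Gʲ) ⊖ (G ⊛ (G ⊛ Gʲ))                 ≈⟨ expand G Gʲ ⟩
      (G ⊛ (one ⊖ G)) ⊛ Gʲ                      ≈⟨ ⊛-congˡ Gʲ Gii-equation ⟩
      (xS ⊛ (R ⊖ ((R ⊖ one) ⊛ G))) ⊛ Gʲ         ≈⟨ regroup xS R G Gʲ ⟩
      xS ⊛ ((R ⊛ Gʲ) ⊖ ((R ⊖ one) ⊛ (G ⊛ Gʲ)))  ∎
      where
      expand : ∀ g p → ((g ⊛ p) ⊖ (g ⊛ (g ⊛ p))) ≈ ((g ⊛ (con 1ℚ ⊖ g)) ⊛ p)
      expand = solve 2 (λ g p → (g :* p) :- (g :* (g :* p)) := (g :* (K 1ℚ :- g)) :* p) ≈-refl
      regroup : ∀ x ρ g p → ((x ⊛ (ρ ⊖ ((ρ ⊖ con 1ℚ) ⊛ g))) ⊛ p) ≈ (x ⊛ ((ρ ⊛ p) ⊖ ((ρ ⊖ con 1ℚ) ⊛ (g ⊛ p))))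
      regroup = solve 4 (λ x ρ g p → (x :* (ρ :- ((ρ :- K 1ℚ) :* g))) :* p := x :* ((ρ :* p) :- ((ρ :- K 1ℚ) :* (g :* p)))) ≈-refl

  P-column0 : ∀ i → Pmat r i 0 ≡ 0ℚ
  P-column0 zero    = refl
  P-column0 (suc i) = refl

  P-lower : ∀ i j → j < i → Pmat r i (suc j) ≡ 1ℚ
  P-lower (suc i) j (s≤s j≤i) with ℕ.compare j i
  ... | ℕ.less _ _    = refl
  ... | ℕ.equal _     = refl
  ... | ℕ.greater _ k = contradiction j≤i (ℕP.<⇒≱ (s≤s (ℕP.m≤m+n _ k)))

  P-superdiagonal : ∀ i → Pmat r i (suc i) ≡ ρ
  P-superdiagonal zero    = refl
  P-superdiagonal (suc i) = superdiagonal i (suc i) refl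
    where
    superdiagonal : ∀ i j → j ≡ suc i → Pmat r (suc i) (suc j) ≡ ρ
    superdiagonal i j j≡1+i with ℕ.compare j i
    ... | ℕ.less m k        = contradiction j≡1+i (ℕP.<⇒≢ (s≤s (ℕP.≤-trans (ℕP.m≤m+n m k) (ℕP.n≤1+n _))))
    ... | ℕ.equal m         = contradiction j≡1+i (ℕP.<⇒≢ (ℕP.n<1+n m))
    ... | ℕ.greater m zero  = refl
    ... | ℕ.greater m (suc k) =
      contradiction (ℕP.suc-injective j≡1+i) (ℕP.>⇒≢ (ℕP.≤-trans (s≤s (ℕP.m≤m+n m k)) (ℕP.≤-reflexive (sym (ℕP.+-suc m k)))))

  P-far : ∀ i k → suc (suc i) ≤ k → Pmat r i k ≡ 0ℚ
  P-far zero    (suc zero)    (s≤s ())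
  P-far zero    (suc (suc k)) _ = refl
  P-far (suc i) (suc k) (s≤s 2+i≤k) with ℕ.compare k i
  ... | ℕ.less m _          = contradiction 2+i≤k (ℕP.<⇒≱ (s≤s (ℕP.m≤n⇒m≤1+n (ℕP.m≤n⇒m≤1+n (ℕP.m≤m+n m _)))))
  ... | ℕ.equal m           = contradiction 2+i≤k (ℕP.<⇒≱ (ℕP.n≤1+n (suc m)))
  ... | ℕ.greater m zero    = contradiction 2+i≤k (ℕP.<⇒≱ (s≤s (s≤s (ℕP.≤-reflexive (ℕP.+-identityʳ m)))))
  ... | ℕ.greater m (suc k) = refl

  private
    step-from-entries : ∀ {p p' a b x x' y y'} → p ≡ x → p' ≡ x' → a ≡ y → b ≡ y' →
                        x ≡ x' + (ρ * y - (ρ - 1ℚ) * y') → p ≡ p' + (ρ * a - (ρ - 1ℚ) * b)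
    step-from-entries refl refl refl refl eq = eq

  P-column-step : ∀ i j → Pmat r i (suc j) ≡ Pmat r i (suc (suc j)) + (ρ * I i j - (ρ - 1ℚ) * I i (suc j))
  P-column-step i j with ℕP.<-cmp i j
  ... | tri< i<j _ _ =
    step-from-entries (P-far i (suc j) (s≤s i<j)) (P-far i (suc (suc j)) (s≤s (ℕP.m≤n⇒m≤1+n i<j)))
      (I-≢ i j (ℕP.<⇒≢ i<j)) (I-≢ i (suc j) (ℕP.<⇒≢ (ℕP.m<n⇒m<1+n i<j))) (values (ρ))
    where
    values : ∀ p → 0ℚ ≡ 0ℚ + (p * 0ℚ - (p - 1ℚ) * 0ℚ)
    values = solve-∀ ℚ-ring
  ... | tri≈ _ refl _ =
    step-from-entries (P-superdiagonal i) (P-far i (suc (suc i)) ℕP.≤-refl) (I-≡ i) (I-≢ i (suc i) (ℕP.<⇒≢ ℕP.≤-refl)) (values (ρ))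
    where
    values : ∀ p → p ≡ 0ℚ + (p * 1ℚ - (p - 1ℚ) * 0ℚ)
    values = solve-∀ ℚ-ring
  P-column-step (suc i) j | tri> _ _ (s≤s j≤i) with ℕP.m≤n⇒m<n∨m≡n j≤i
  ... | inj₂ refl =
    step-from-entries (P-lower (suc i) i (s≤s ℕP.≤-refl)) (P-superdiagonal (suc i)) (I-≢ (suc i) i (ℕP.>⇒≢ ℕP.≤-refl)) (I-≡ (suc i))
      (values (ρ))
    where
    values : ∀ p → 1ℚ ≡ p + (p * 0ℚ - (p - 1ℚ) * 1ℚ)
    values = solve-∀ ℚ-ring
  ... | inj₁ j<i =
    step-from-entries (P-lower (suc i) j (s≤s j≤i)) (P-lower (suc i) (suc j) (s≤s j<i))
      (I-≢ (suc i) j (ℕP.>⇒≢ (s≤s j≤i))) (I-≢ (suc i) (suc j) (ℕP.>⇒≢ (s≤s j<i))) (values (ρ))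
    where
    values : ∀ p → 1ℚ ≡ 1ℚ + (p * 0ℚ - (p - 1ℚ) * 0ℚ)
    values = solve-∀ ℚ-ring

  production : Matrix → ℕ → ℕ → ℚ
  production M n k = sumTo (suc n) (λ i → M n i * Pmat r i k)

  production-column-step : ∀ M → LowerTriangular M → ∀ n j →
    production M n (suc j) ≡ production M n (suc (suc j)) + (ρ * M n j - (ρ - 1ℚ) * M n (suc j))
  production-column-step M M-lower n j = begin
    production M n (suc j)
      ≡⟨ sumTo-cong (suc n) (λ i → trans (cong (M n i *_) (P-column-step i j)) (distribute (M n i) _ (I i j) (I i (suc j)))) ⟩
    sumTo (suc n) (λ i → M n i * Pmat r i (suc (suc j)) + (ρ * (M n i * I i j) - (ρ - 1ℚ) * (M n i * I i (suc j))))
      ≡⟨ sumTo-+ (suc n) _ _ ⟩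
    production M n (suc (suc j)) + sumTo (suc n) (λ i → ρ * (M n i * I i j) - (ρ - 1ℚ) * (M n i * I i (suc j)))
      ≡⟨ cong (production M n (suc (suc j)) +_) (trans (sumTo-+ (suc n) _ _) (cong₂ _+_ (sumTo-*ˡ (suc n) (ρ) _)
           (trans (sumTo-neg (suc n) _) (cong -_ (sumTo-*ˡ (suc n) (ρ - 1ℚ) _))))) ⟩
    production M n (suc (suc j)) + (ρ * (M ⊙ I) n j - (ρ - 1ℚ) * (M ⊙ I) n (suc j))
      ≡⟨ cong₂ (λ a b → production M n (suc (suc j)) + (ρ * a - (ρ - 1ℚ) * b))
               (⊙-identityʳ M M-lower n j) (⊙-identityʳ M M-lower n (suc j)) ⟩
    production M n (suc (suc j)) + (ρ * M n j - (ρ - 1ℚ) * M n (suc j)) ∎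
    where
    open ≡-Reasoning
    distribute : ∀ m p a b → m * (p + (ρ * a - (ρ - 1ℚ) * b)) ≡ m * p + (ρ * (m * a) - (ρ - 1ℚ) * (m * b))
    distribute m p a b = identity (ρ) m p a b
      where
      identity : ∀ q m p a b → m * (p + (q * a - (q - 1ℚ) * b)) ≡ m * p + (q * (m * a) - (q - 1ℚ) * (m * b))
      identity = solve-∀ ℚ-ring

  -- Both sides satisfy the same column step (P-column-step against
  -- RG-column-recurrence) and vanish far to the right of the diagonal.
  RG-production-column : ∀ n d j → suc n ≤ j ℕ.+ d → RG (suc n) (suc j) ≡ production (RG) n (suc j)
  RG-production-column n zero j n<j = trans (RG-lowerTriangular (suc n) (suc j) (s≤s n<j+0))
    (sym (sumTo-zero (suc n) (λ i i<1+n →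
      trans (cong (RG n i *_) (P-far i (suc j) (s≤s (ℕP.≤-trans i<1+n n<j+0)))) (ℚP.*-zeroʳ (RG n i)))))
    where
    n<j+0 : suc n ≤ j
    n<j+0 = subst (suc n ≤_) (ℕP.+-identityʳ j) n<j
  RG-production-column n (suc d) j n<j+1+d =
    trans (RG-column-recurrence n j)
    (trans (cong (_+ (ρ * RG n j - (ρ - 1ℚ) * RG n (suc j)))
                 (RG-production-column n d (suc j) (subst (suc n ≤_) (ℕP.+-suc j d) n<j+1+d)))
           (sym (production-column-step (RG) (RG-lowerTriangular) n j)))

  RG-production : ∀ n k → RG (suc n) k ≡ production (RG) n k
  RG-production n zero    = trans (RG-at (suc n) 0)
    (sym (sumTo-zero (suc n) (λ i _ → trans (cong (RG n i *_) (P-column0 i)) (ℚP.*-zeroʳ (RG n i)))))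
  RG-production n (suc j) = RG-production-column n (suc n) j (ℕP.m≤n+m (suc n) j)

  AP≐RG : AP r ≐ RG
  AP≐RG zero    zero    = refl
  AP≐RG zero    (suc k) = sym (RG-lowerTriangular 0 (suc k) (s≤s z≤n))
  AP≐RG (suc n) k       = trans (sumTo-cong (suc n) (λ i → cong (_* Pmat r i k) (AP≐RG n i))) (sym (RG-production n k))

  Fii-0 : Fii r 0 ≡ 0ℚ
  Fii-0 = trans (⊛-0 (xS ⊛ 1-x) (invS den)) (trans (cong (_* invS den 0) (xS⊛-0 1-x)) (ℚP.*-zeroˡ (invS den 0)))
    where
    1-x den : Series
    1-x = poly (1ℚ ∷ (- 1ℚ) ∷ [])
    den = poly (ρ ∷ (- (ρ - 1ℚ)) ∷ [])

  AP-inverseʳ : r ≢ ℤ.+ 0 → (AP r ⊙ Riordan oneS (Fii r)) ≐ I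
  AP-inverseʳ r≢0 = ≐-trans (⊙-congˡ (Riordan oneS (Fii r)) AP≐RG)
    (Riordan-inverse oneS oneS (Fii r) Gii-0 (≈-trans (⊛-identityˡ _) (∘ˢ-oneS Gii-0)) (Fii∘Gii≈xS r≢0))

  AP-lowerTriangular : LowerTriangular (AP r)
  AP-lowerTriangular n k n<k = trans (AP≐RG n k) (RG-lowerTriangular n k n<k)

  AP-inverseˡ : r ≢ ℤ.+ 0 → (Riordan oneS (Fii r) ⊙ AP r) ≐ I
  AP-inverseˡ r≢0 = ⊙-inverse-comm (AP r) (Riordan oneS (Fii r)) AP-lowerTriangular
    (Riordan-lowerTriangular oneS Fii-0) (AP-inverseʳ r≢0)

-- Tridiagonal recurrences and Hankel matrices

-- Row n + 1 of M is row n times the tridiagonal matrix with diagonal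
-- (ρ, ρ + 1, ρ + 1, …), subdiagonal ρ and superdiagonal 1.
record TridiagonalRecurrence (ρ : ℚ) (M : Matrix) : Set where
  field
    step₀ : ∀ n → M (suc n) 0 ≡ ρ * M n 0 + ρ * M n 1
    step  : ∀ n k → M (suc n) (suc k) ≡ M n k + (ρ + 1ℚ) * M n (suc k) + ρ * M n (suc (suc k))

recurrence-unique : ∀ {ρ M N} → TridiagonalRecurrence ρ M → TridiagonalRecurrence ρ N → (∀ k → M 0 k ≡ N 0 k) → M ≐ N
recurrence-unique {ρ} {M} {N} recM recN row0 = rows
  where
  module RM = TridiagonalRecurrence recM
  module RN = TridiagonalRecurrence recN
  rows : M ≐ N
  rows zero    k       = row0 k
  rows (suc n) zero    = trans (RM.step₀ n) (trans (cong₂ (λ a b → ρ * a + ρ * b) (rows n 0) (rows n 1)) (sym (RN.step₀ n)))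
  rows (suc n) (suc k) = trans (RM.step n k)
    (trans (cong₂ (λ a b → a + (ρ + 1ℚ) * b + ρ * M n (suc (suc k))) (rows n k) (rows n (suc k)))
    (trans (cong (λ c → N n k + (ρ + 1ℚ) * N n (suc k) + ρ * c) (rows n (suc (suc k)))) (sym (RN.step n k))))

module Hankel {ρ M} (rec : TridiagonalRecurrence ρ M) (M-lower : LowerTriangular M) (M-row0 : ∀ k → M 0 k ≡ I 0 k) where
  open TridiagonalRecurrence rec

  weighted : ℕ → ℕ → ℕ → ℚ
  weighted N i j = sumTo N (λ m → M i m * ρ ^ℚ m * M j m)

  weighted-extend : ∀ i j N → suc i ≤ N → weighted (suc i) i j ≡ weighted N i j
  weighted-extend i j N 1+i≤N = sumTo-extend N _ 1+i≤N (λ m i<m _ →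
    trans (cong (λ z → z * ρ ^ℚ m * M j m) (M-lower i m i<m))
          (trans (cong (_* M j m) (ℚP.*-zeroˡ (ρ ^ℚ m))) (ℚP.*-zeroˡ (M j m))))

  -- Substituting the recurrence for M (suc i) m, and for M (suc j) m on the
  -- other side, the two weighted sums differ by a telescoping sum.
  weighted-shift : ∀ i j N → suc i ≤ N → weighted (suc N) (suc i) j ≡ weighted (suc N) i (suc j)
  weighted-shift i j N 1+i≤N =
    trans (sumTo-head N f)
    (trans (cong₂ _+_ f0 (trans (sumTo-cong N fs) (trans (sumTo-+ N (λ m → g (suc m)) (λ m → a m - a (suc m)))
              (cong (sumTo N (λ m → g (suc m)) +_) (sumTo-telescope N a)))))
    (trans (cancel (g 0) (a 0) (sumTo N (λ m → g (suc m))) (a N) aN≡0) (sym (sumTo-head N g))))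
    where
    f g a : ℕ → ℚ
    f m = M (suc i) m * ρ ^ℚ m * M j m
    g m = M i m * ρ ^ℚ m * M (suc j) m
    a m = M i m * ρ ^ℚ (suc m) * M j (suc m) - M i (suc m) * ρ ^ℚ (suc m) * M j m
    f0 : f 0 ≡ g 0 - a 0
    f0 = trans (cong (λ z → z * 1ℚ * M j 0) (step₀ i))
         (trans (identity ρ (M i 0) (M i 1) (M j 0) (M j 1))
         (cong (λ z → M i 0 * 1ℚ * z - a 0) (sym (step₀ j))))
      where
      identity : ∀ p x₀ x₁ y₀ y₁ → (p * x₀ + p * x₁) * 1ℚ * y₀ ≡ x₀ * 1ℚ * (p * y₀ + p * y₁) - (x₀ * (p * 1ℚ) * y₁ - x₁ * (p * 1ℚ) * y₀)
      identity = solve-∀ ℚ-ring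
    fs : ∀ m → f (suc m) ≡ g (suc m) + (a m - a (suc m))
    fs m = trans (cong (λ z → z * ρ ^ℚ suc m * M j (suc m)) (step i m))
           (trans (identity ρ (ρ ^ℚ m) (M i m) (M i (suc m)) (M i (suc (suc m))) (M j m) (M j (suc m)) (M j (suc (suc m))))
           (cong (λ z → M i (suc m) * ρ ^ℚ suc m * z + (a m - a (suc m))) (sym (step j m))))
      where
      identity : ∀ p P x₀ x₁ x₂ y₀ y₁ y₂ →
        (x₀ + (p + 1ℚ) * x₁ + p * x₂) * (p * P) * y₁ ≡
        x₁ * (p * P) * (y₀ + (p + 1ℚ) * y₁ + p * y₂) +
          ((x₀ * (p * P) * y₁ - x₁ * (p * P) * y₀) - (x₁ * (p * (p * P)) * y₂ - x₂ * (p * (p * P)) * y₁))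
      identity = solve-∀ ℚ-ring
    aN≡0 : a N ≡ 0ℚ
    aN≡0 = trans (cong₂ (λ x y → x * ρ ^ℚ (suc N) * M j (suc N) - y * ρ ^ℚ (suc N) * M j N)
                       (M-lower i N 1+i≤N) (M-lower i (suc N) (ℕP.m≤n⇒m≤1+n 1+i≤N)))
                 (vanish (ρ ^ℚ (suc N)) (M j (suc N)) (M j N))
      where
      vanish : ∀ P y₁ y₀ → 0ℚ * P * y₁ - 0ℚ * P * y₀ ≡ 0ℚ
      vanish = solve-∀ ℚ-ring
    cancel : ∀ g₀ a₀ s aN → aN ≡ 0ℚ → g₀ - a₀ + (s + (a₀ - aN)) ≡ g₀ + s
    cancel g₀ a₀ s aN refl = identity g₀ a₀ s
      where
      identity : ∀ g₀ a₀ s → g₀ - a₀ + (s + (a₀ - 0ℚ)) ≡ g₀ + s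
      identity = solve-∀ ℚ-ring

  weighted≡column0 : ∀ i j → weighted (suc i) i j ≡ M (i ℕ.+ j) 0
  weighted≡column0 zero j = trans (ℚP.+-identityˡ _) (trans (cong (λ z → z * 1ℚ * M j 0) (M-row0 0)) (unit (M j 0)))
    where
    unit : ∀ x → 1ℚ * 1ℚ * x ≡ x
    unit = solve-∀ ℚ-ring
  weighted≡column0 (suc i) j =
    trans (weighted-shift i j (suc i) ℕP.≤-refl)
    (trans (sym (weighted-extend i (suc j) (suc (suc i)) (ℕP.n≤1+n (suc i))))
    (trans (weighted≡column0 i (suc j)) (cong (λ n → M n 0) (ℕP.+-suc i j))))

  LDLᵀ≡column0 : ∀ i j → ((M ⊙ diag (ρ ^ℚ_)) ⊙ transpose M) i j ≡ M (i ℕ.+ j) 0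
  LDLᵀ≡column0 i j = trans (sumTo-cong-< (suc i) (λ m m<1+i → cong (_* M j m) (MD-at m m<1+i))) (weighted≡column0 i j)
    where
    MD-at : ∀ m → m < suc i → (M ⊙ diag (ρ ^ℚ_)) i m ≡ M i m * ρ ^ℚ m
    MD-at m m<1+i = trans (sumTo-single (suc i) (λ k → M i k * diag (ρ ^ℚ_) k m) m m<1+i
                            (λ k _ k≢m → trans (cong (M i k *_) (diag-≢ (ρ ^ℚ_) k m k≢m)) (ℚP.*-zeroʳ (M i k))))
                          (cong (M i m *_) (diag-≡ (ρ ^ℚ_) m))

-- The array L(r)

module _ (r : ℤ) where

  P-row : ∀ j (v : ℕ → ℚ) → sumTo (suc (suc j)) (λ i → Pmat r j i * v i) ≡ ρ r * v (suc j) + sumTo j (λ i → v (suc i))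
  P-row zero    v = identity (ρ r) (v 0) (v 1)
    where
    identity : ∀ p a b → 0ℚ + 0ℚ * a + p * b ≡ p * b + 0ℚ
    identity = solve-∀ ℚ-ring
  P-row (suc j) v =
    trans (sumTo-head (suc (suc j)) (λ i → Pmat r (suc j) i * v i))
    (trans (cong (0ℚ * v 0 +_) (cong₂ _+_
             (sumTo-cong-< (suc j) (λ i i<1+j → trans (cong (_* v (suc i)) (P-lower r (suc j) i i<1+j)) (ℚP.*-identityˡ (v (suc i)))))
             (cong (_* v (suc (suc j))) (P-superdiagonal r (suc j)))))
    (identity (ρ r) (v 0) (sumTo (suc j) (λ i → v (suc i))) (v (suc (suc j)))))
    where
    identity : ∀ p a s b → 0ℚ * a + (s + p * b) ≡ p * b + s
    identity = solve-∀ ℚ-ring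

  P-row-extend : ∀ j N (v : ℕ → ℚ) → suc (suc j) ≤ N → sumTo N (λ i → Pmat r j i * v i) ≡ ρ r * v (suc j) + sumTo j (λ i → v (suc i))
  P-row-extend j N v 2+j≤N =
    trans (sym (sumTo-extend N _ 2+j≤N (λ i 2+j≤i _ → trans (cong (_* v i) (P-far r j i 2+j≤i)) (ℚP.*-zeroˡ (v i)))))
          (P-row j v)

  private
    hockeyStick : ∀ j k → sumTo j (λ i → B (suc i) k) + B 0 k ≡ B (suc j) (suc k)
    hockeyStick j k = trans (ℚP.+-comm _ (B 0 k)) (trans (sym (sumTo-head j (λ i → B i k))) (B-hockeyStick j k))

  P⊙B-column0 : ∀ j N → suc (suc j) ≤ N → sumTo N (λ i → Pmat r j i * B i 0) ≡ ρ r * B j 0 + B j 1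
  P⊙B-column0 j N 2+j≤N = trans (P-row-extend j N (λ i → B i 0) 2+j≤N) (cong (ρ r * 1ℚ +_)
    (+-cancelˡ 1ℚ (sumTo j (λ i → B (suc i) 0)) (B j 1) (trans (ℚP.+-comm 1ℚ (sumTo j (λ i → B (suc i) 0))) (trans (hockeyStick j 0) (B-pascal j 0)))))

  P⊙B-column-suc : ∀ j k N → suc (suc j) ≤ N →
    sumTo N (λ i → Pmat r j i * B i (suc k)) ≡ ρ r * B j k + (ρ r + 1ℚ) * B j (suc k) + B j (suc (suc k))
  P⊙B-column-suc j k N 2+j≤N = trans (P-row-extend j N (λ i → B i (suc k)) 2+j≤N)
    (trans (cong₂ _+_ (cong (ρ r *_) (B-pascal j k))
                      (trans (sym (ℚP.+-identityʳ _)) (trans (cong (sumTo j (λ i → B (suc i) (suc k)) +_) (sym (B-vanish {0} {suc k} (s≤s z≤n))))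
                             (trans (hockeyStick j (suc k)) (B-pascal j (suc k))))))
    (collect (ρ r) (B j k) (B j (suc k)) (B j (suc (suc k)))))
    where
    collect : ∀ p a b c → p * (a + b) + (b + c) ≡ p * a + (p + 1ℚ) * b + c
    collect = solve-∀ ℚ-ring

  AB : Matrix
  AB = AP r ⊙ B

  AB-row-suc : ∀ n k → AB (suc n) k ≡ sumTo (suc n) (λ j → AP r n j * sumTo (suc (suc n)) (λ i → Pmat r j i * B i k))
  AB-row-suc n k =
    trans (sumTo-cong (suc (suc n)) (λ i → sym (sumTo-*ʳ (suc n) (B i k) (λ j → AP r n j * Pmat r j i))))
    (trans (sumTo-swap (suc (suc n)) (suc n) (λ i j → AP r n j * Pmat r j i * B i k))
    (sumTo-cong (suc n) (λ j → trans (sumTo-cong (suc (suc n)) (λ i → ℚP.*-assoc (AP r n j) (Pmat r j i) (B i k)))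
       (sumTo-*ˡ (suc (suc n)) (AP r n j) (λ i → Pmat r j i * B i k)))))

  AB-step₀ : ∀ n → AB (suc n) 0 ≡ ρ r * AB n 0 + AB n 1
  AB-step₀ n = trans (AB-row-suc n 0)
    (trans (sumTo-cong-< (suc n) (λ j j<1+n → cong (AP r n j *_) (P⊙B-column0 j (suc (suc n)) (s≤s j<1+n))))
    (trans (sumTo-cong (suc n) (λ j → distribute (ρ r) (AP r n j) (B j 0) (B j 1)))
    (trans (sumTo-+ (suc n) _ _) (cong (_+ AB n 1) (sumTo-*ˡ (suc n) (ρ r) _)))))
    where
    distribute : ∀ p a b c → a * (p * b + c) ≡ p * (a * b) + a * c
    distribute = solve-∀ ℚ-ring

  AB-step : ∀ n k → AB (suc n) (suc k) ≡ ρ r * AB n k + (ρ r + 1ℚ) * AB n (suc k) + AB n (suc (suc k))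
  AB-step n k = trans (AB-row-suc n (suc k))
    (trans (sumTo-cong-< (suc n) (λ j j<1+n → cong (AP r n j *_) (P⊙B-column-suc j k (suc (suc n)) (s≤s j<1+n))))
    (trans (sumTo-cong (suc n) (λ j → distribute (ρ r) (AP r n j) (B j k) (B j (suc k)) (B j (suc (suc k)))))
    (trans (sumTo-+ (suc n) _ _) (cong (_+ AB n (suc (suc k)))
      (trans (sumTo-+ (suc n) _ _) (cong₂ _+_ (sumTo-*ˡ (suc n) (ρ r) _) (sumTo-*ˡ (suc n) (ρ r + 1ℚ) _)))))))
    where
    distribute : ∀ p a b c d → a * (p * b + (p + 1ℚ) * c + d) ≡ p * (a * b) + (p + 1ℚ) * (a * c) + a * d
    distribute = solve-∀ ℚ-ring

  AB-lowerTriangular : LowerTriangular AB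
  AB-lowerTriangular n k n<k = sumTo-zero (suc n) (λ j j<1+n →
    trans (cong (AP r n j *_) (B-vanish (ℕP.<-≤-trans j<1+n n<k))) (ℚP.*-zeroʳ (AP r n j)))

  AB-row0 : ∀ k → AB 0 k ≡ I 0 k
  AB-row0 zero    = refl
  AB-row0 (suc k) = trans (ℚP.+-identityˡ (1ℚ * B 0 (suc k))) (trans (cong (1ℚ *_) (B-vanish {0} {suc k} (s≤s z≤n))) (ℚP.*-zeroʳ 1ℚ))

  Dinv-at : ∀ j k → Dinv r j k ≡ recip (ρ r) ^ℚ k * I j k
  Dinv-at j k = trans (⊛-identityˡ-at ((recip (ρ r) · xS) ^S k) j)
    (trans (at (·xS-^S (recip (ρ r)) k) j) (cong (recip (ρ r) ^ℚ k *_) (xS^S-at k j)))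

  L-at : ∀ n k → L r n k ≡ AB n k * recip (ρ r) ^ℚ k
  L-at n k = begin
    L r n k                                          ≡⟨ sumTo-cong (suc n) (λ j → trans (cong (AB n j *_) (Dinv-at j k)) (swap (AB n j) c^k (I j k))) ⟩
    sumTo (suc n) (λ j → c^k * (AB n j * I j k))   ≡⟨ sumTo-*ˡ (suc n) c^k _ ⟩
    c^k * (AB ⊙ I) n k                             ≡⟨ cong (c^k *_) (⊙-identityʳ (AB) (AB-lowerTriangular) n k) ⟩
    c^k * AB n k                                   ≡⟨ ℚP.*-comm c^k (AB n k) ⟩
    AB n k * c^k                                   ∎
    where
    open ≡-Reasoning
    c^k : ℚ
    c^k = recip (ρ r) ^ℚ k
    swap : ∀ a b d → a * (b * d) ≡ b * (a * d)
    swap = solve-∀ ℚ-ring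

  L-lowerTriangular : LowerTriangular (L r)
  L-lowerTriangular n k n<k =
    trans (L-at n k) (trans (cong (_* recip (ρ r) ^ℚ k) (AB-lowerTriangular n k n<k)) (ℚP.*-zeroˡ (recip (ρ r) ^ℚ k)))

  L-row0 : ∀ k → L r 0 k ≡ I 0 k
  L-row0 zero    = trans (L-at 0 0) (cong (_* 1ℚ) (AB-row0 0))
  L-row0 (suc k) =
    trans (L-at 0 (suc k)) (trans (cong (_* recip (ρ r) ^ℚ suc k) (AB-row0 (suc k))) (ℚP.*-zeroˡ (recip (ρ r) ^ℚ suc k)))

  L-recurrence : r ≢ ℤ.+ 0 → TridiagonalRecurrence (ρ r) (L r)
  L-recurrence r≢0 = record { step₀ = step₀ ; step = step }
    where
    p c : ℚ
    p = ρ r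
    c = recip p
    pc≡1 : p * c ≡ 1ℚ
    pc≡1 = recip-inverseʳ p (ι≢0 r r≢0)
    -- The ring solver treats p and c = p⁻¹ as independent, so the identities
    -- below hold only up to a multiple of p c - 1.
    using-pc≡1 : ∀ {x y} z → x ≡ y + (p * c - 1ℚ) * z → x ≡ y
    using-pc≡1 {y = y} z eq = trans eq (trans (cong (λ w → y + (w - 1ℚ) * z) pc≡1) (vanish y z))
      where
      vanish : ∀ y z → y + (1ℚ - 1ℚ) * z ≡ y
      vanish = solve-∀ ℚ-ring
    step₀ : ∀ n → L r (suc n) 0 ≡ p * L r n 0 + p * L r n 1
    step₀ n = trans (L-at (suc n) 0) (trans (cong (_* 1ℚ) (AB-step₀ n))
      (trans (using-pc≡1 (- AB n 1) (identity p c (AB n 0) (AB n 1)))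
      (sym (cong₂ (λ a b → p * a + p * b) (L-at n 0) (L-at n 1)))))
      where
      identity : ∀ p c a b → (p * a + b) * 1ℚ ≡ p * (a * 1ℚ) + p * (b * (c * 1ℚ)) + (p * c - 1ℚ) * (- b)
      identity = solve-∀ ℚ-ring
    step : ∀ n k → L r (suc n) (suc k) ≡ L r n k + (p + 1ℚ) * L r n (suc k) + p * L r n (suc (suc k))
    step n k = trans (L-at (suc n) (suc k)) (trans (cong (_* c ^ℚ (suc k)) (AB-step n k))
      (trans (using-pc≡1 (AB n k * c ^ℚ k - AB n (suc (suc k)) * c * c ^ℚ k) (identity p c (c ^ℚ k) (AB n k) (AB n (suc k)) (AB n (suc (suc k)))))
      (sym (cong₂ _+_ (cong₂ (λ a b → a + (p + 1ℚ) * b) (L-at n k) (L-at n (suc k))) (cong (p *_) (L-at n (suc (suc k))))))))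
      where
      identity : ∀ p c C a b d → (p * a + (p + 1ℚ) * b + d) * (c * C)
        ≡ a * C + (p + 1ℚ) * (b * (c * C)) + p * (d * (c * (c * C))) + (p * c - 1ℚ) * (a * C - d * c * C)
      identity = solve-∀ ℚ-ring

module _ (r : ℤ) (r≢0 : r ≢ ℤ.+ 0) where

  private
    p q : ℚ
    p = ρ r
    q = recip (ιℕ 2 * p)
    S Q gl fl : Series
    S  = sqrtΔ r
    Q  = con q
    gl = gL r
    fl = fL r
    -- x gL = ½ b and x fL = c / (2r)
    b c : Series
    b = (one ⊕ (negS (R r ⊖ one) ⊛ xS)) ⊖ S
    c = (one ⊕ (negS (R r ⊕ one) ⊛ xS)) ⊖ S

  2rq-1≈0 : (((con (ιℕ 2) ⊛ R r) ⊛ Q) ⊖ one) ≈ zeroS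
  2rq-1≈0 = ⊖-self≈zero (≈-trans (≈-sym (≈-trans (con-* (ιℕ 2 * p) q) (⊛-congˡ Q (con-* (ιℕ 2) p))))
    (mk λ n → cong (_* oneS n) (recip-inverseʳ (ιℕ 2 * p) 2p≢0)))
    where
    2p≢0 : ιℕ 2 * p ≢ 0ℚ
    2p≢0 2p≡0 = ι≢0 r r≢0 (trans (sym (trans (sym (ℚP.*-assoc ½ (ιℕ 2) p)) (ℚP.*-identityˡ p)))
                                 (trans (cong (½ *_) 2p≡0) (ℚP.*-zeroʳ ½)))

  xS⊛gL≈ : (xS ⊛ gl) ≈ (con ½ ⊛ b)
  xS⊛gL≈ = ≈-trans (≈-sym (xS⊛-divX (½ · b₀) refl)) (≈-trans (·≈con⊛ ½ b₀) (⊛-congʳ (con ½) (⊖-cong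
    (≈-trans (poly₂≈ 1ℚ (- (p - 1ℚ))) (⊕-cong (≈-refl {one}) (⊛-congˡ xS (≈-trans (con-neg (p - 1ℚ)) (negS-cong (con-minus p 1ℚ))))))
    (≈-refl {S}))))
    where
    b₀ : Series
    b₀ = poly (1ℚ ∷ (- (p - 1ℚ)) ∷ []) ⊖ S

  xS⊛fL≈ : (xS ⊛ fl) ≈ (Q ⊛ c)
  xS⊛fL≈ = ≈-trans (≈-sym (xS⊛-divX (q · c₀) (ℚP.*-zeroʳ q))) (≈-trans (·≈con⊛ q c₀) (⊛-congʳ Q (⊖-cong
    (≈-trans (poly₂≈ 1ℚ (- (p + 1ℚ))) (⊕-cong (≈-refl {one}) (⊛-congˡ xS (≈-trans (con-neg (p + 1ℚ)) (negS-cong (con-+ p 1ℚ))))))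
    (≈-refl {S}))))
    where
    c₀ : Series
    c₀ = poly (1ℚ ∷ (- (p + 1ℚ)) ∷ []) ⊖ S

  gL≈1+rfL : gl ≈ (one ⊕ (R r ⊛ fl))
  gL≈1+rfL = xS⊛-cancel (begin
    xS ⊛ gl                          ≈⟨ xS⊛gL≈ ⟩
    con ½ ⊛ b                        ≈⟨ drop-⊛-zero (con (- ½) ⊛ c) (identity S xS (R r) Q) 2rq-1≈0 ⟩
    xS ⊕ (R r ⊛ (Q ⊛ c))             ≈⟨ ⊕-cong (≈-refl {xS}) (⊛-congʳ (R r) (≈-sym xS⊛fL≈)) ⟩
    xS ⊕ (R r ⊛ (xS ⊛ fl))           ≈⟨ factor xS (R r) fl ⟩
    xS ⊛ (one ⊕ (R r ⊛ fl))          ∎)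
    where
    open ≈-Reasoning
    identity : ∀ s x ρ q →
      (con ½ ⊛ ((con 1ℚ ⊕ (negS (ρ ⊖ con 1ℚ) ⊛ x)) ⊖ s)) ≈
      ((x ⊕ (ρ ⊛ (q ⊛ ((con 1ℚ ⊕ (negS (ρ ⊕ con 1ℚ) ⊛ x)) ⊖ s)))) ⊕
         ((con (- ½) ⊛ ((con 1ℚ ⊕ (negS (ρ ⊕ con 1ℚ) ⊛ x)) ⊖ s)) ⊛ (((con (ιℕ 2) ⊛ ρ) ⊛ q) ⊖ con 1ℚ)))
    identity = solve 4 (λ s x ρ q →
      (K ½ :* ((K 1ℚ :+ ((:- (ρ :- K 1ℚ)) :* x)) :- s)) :=
      ((x :+ (ρ :* (q :* ((K 1ℚ :+ ((:- (ρ :+ K 1ℚ)) :* x)) :- s)))) :+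
         ((K (- ½) :* ((K 1ℚ :+ ((:- (ρ :+ K 1ℚ)) :* x)) :- s)) :* (((K (ιℕ 2) :* ρ) :* q) :- K 1ℚ)))) ≈-refl
    factor : ∀ x ρ f → (x ⊕ (ρ ⊛ (x ⊛ f))) ≈ (x ⊛ (con 1ℚ ⊕ (ρ ⊛ f)))
    factor = solve 3 (λ x ρ f → x :+ (ρ :* (x :* f)) := x :* (K 1ℚ :+ (ρ :* f))) ≈-refl

  fL≈x[1+fL]gL : fl ≈ (xS ⊛ ((one ⊕ fl) ⊛ gl))
  fL≈x[1+fL]gL = xS⊛-cancel (begin
    xS ⊛ fl                               ≈⟨ xS⊛fL≈ ⟩
    Q ⊛ c                                 ≈⟨ ≈-sym (drop-⊛-zero (con (- ½) ⊛ (xS ⊛ b))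
                                               (drop-⊛-zero (con ½ ⊛ Q) (identity S xS (R r) Q) (sqrtΔ²-Δ≈0 r)) 2rq-1≈0) ⟩
    (xS ⊕ (Q ⊛ c)) ⊛ (con ½ ⊛ b)          ≈⟨ ⊛-cong (⊕-cong (≈-refl {xS}) (≈-sym xS⊛fL≈)) (≈-sym xS⊛gL≈) ⟩
    (xS ⊕ (xS ⊛ fl)) ⊛ (xS ⊛ gl)          ≈⟨ factor xS fl gl ⟩
    xS ⊛ (xS ⊛ ((one ⊕ fl) ⊛ gl))         ∎)
    where
    open ≈-Reasoning
    identity : ∀ s x ρ q →
      ((x ⊕ (q ⊛ ((con 1ℚ ⊕ (negS (ρ ⊕ con 1ℚ) ⊛ x)) ⊖ s))) ⊛ (con ½ ⊛ ((con 1ℚ ⊕ (negS (ρ ⊖ con 1ℚ) ⊛ x)) ⊖ s))) ≈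
      (((q ⊛ ((con 1ℚ ⊕ (negS (ρ ⊕ con 1ℚ) ⊛ x)) ⊖ s)) ⊕
         ((con (- ½) ⊛ (x ⊛ ((con 1ℚ ⊕ (negS (ρ ⊖ con 1ℚ) ⊛ x)) ⊖ s))) ⊛ (((con (ιℕ 2) ⊛ ρ) ⊛ q) ⊖ con 1ℚ))) ⊕
       ((con ½ ⊛ q) ⊛ ((s ⊛ s) ⊖ ((con 1ℚ ⊕ (negS (con (ιℕ 2) ⊛ (ρ ⊕ con 1ℚ)) ⊛ x)) ⊕ (((ρ ⊖ con 1ℚ) ⊛ (ρ ⊖ con 1ℚ)) ⊛ (x ⊛ x))))))
    identity = solve 4 (λ s x ρ q →
      ((x :+ (q :* ((K 1ℚ :+ ((:- (ρ :+ K 1ℚ)) :* x)) :- s))) :* (K ½ :* ((K 1ℚ :+ ((:- (ρ :- K 1ℚ)) :* x)) :- s))) :=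
      (((q :* ((K 1ℚ :+ ((:- (ρ :+ K 1ℚ)) :* x)) :- s)) :+
         ((K (- ½) :* (x :* ((K 1ℚ :+ ((:- (ρ :- K 1ℚ)) :* x)) :- s))) :* (((K (ιℕ 2) :* ρ) :* q) :- K 1ℚ))) :+
       ((K ½ :* q) :* ((s :* s) :- ((K 1ℚ :+ ((:- (K (ιℕ 2) :* (ρ :+ K 1ℚ))) :* x)) :+ (((ρ :- K 1ℚ) :* (ρ :- K 1ℚ)) :* (x :* x))))))) ≈-refl
    factor : ∀ x f g → ((x ⊕ (x ⊛ f)) ⊛ (x ⊛ g)) ≈ (x ⊛ (x ⊛ ((con 1ℚ ⊕ f) ⊛ g)))
    factor = solve 3 (λ x f g → (x :+ (x :* f)) :* (x :* g) := x :* (x :* ((K 1ℚ :+ f) :* g))) ≈-refl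

  fL-0 : fl 0 ≡ 0ℚ
  fL-0 = trans (at fL≈x[1+fL]gL 0) (xS⊛-0 ((one ⊕ fl) ⊛ gl))

  gL-0 : gl 0 ≡ 1ℚ
  gL-0 = trans (at gL≈1+rfL 0) (trans (cong (one 0 +_) (trans (con⊛-at p fl 0) (trans (cong (p *_) fL-0) (ℚP.*-zeroʳ p))))
          (trans (ℚP.+-identityʳ (one 0)) (ℚP.*-identityˡ 1ℚ)))

  Riordan-gL-fL-recurrence : TridiagonalRecurrence p (Riordan gl fl)
  Riordan-gL-fL-recurrence = record { step₀ = step₀ ; step = step }
    where
    open ≈-Reasoning
    column0 : gl ≈ (one ⊕ (xS ⊛ (R r ⊛ (gl ⊕ (gl ⊛ fl)))))
    column0 = begin
      gl                                      ≈⟨ gL≈1+rfL ⟩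
      one ⊕ (R r ⊛ fl)                        ≈⟨ ⊕-cong (≈-refl {one}) (⊛-congʳ (R r) fL≈x[1+fL]gL) ⟩
      one ⊕ (R r ⊛ (xS ⊛ ((one ⊕ fl) ⊛ gl)))  ≈⟨ regroup xS (R r) fl gl ⟩
      one ⊕ (xS ⊛ (R r ⊛ (gl ⊕ (gl ⊛ fl))))   ∎
      where
      regroup : ∀ x ρ f g → (con 1ℚ ⊕ (ρ ⊛ (x ⊛ ((con 1ℚ ⊕ f) ⊛ g)))) ≈ (con 1ℚ ⊕ (x ⊛ (ρ ⊛ (g ⊕ (g ⊛ f)))))
      regroup = solve 4 (λ x ρ f g → K 1ℚ :+ (ρ :* (x :* ((K 1ℚ :+ f) :* g))) := K 1ℚ :+ (x :* (ρ :* (g :+ (g :* f))))) ≈-refl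
    column-suc : ∀ P → (gl ⊛ (fl ⊛ P)) ≈ (xS ⊛ (((gl ⊛ P) ⊕ ((R r ⊕ one) ⊛ (gl ⊛ (fl ⊛ P)))) ⊕ (R r ⊛ (gl ⊛ (fl ⊛ (fl ⊛ P))))))
    column-suc P = ≈-trans (⊛-congʳ gl (⊛-congˡ P (≈-trans fL≈x[1+fL]gL (⊛-congʳ xS (⊛-congʳ (one ⊕ fl) gL≈1+rfL)))))
                           (regroup xS (R r) fl gl P)
      where
      regroup : ∀ x ρ f g P → (g ⊛ ((x ⊛ ((con 1ℚ ⊕ f) ⊛ (con 1ℚ ⊕ (ρ ⊛ f)))) ⊛ P)) ≈
                              (x ⊛ (((g ⊛ P) ⊕ ((ρ ⊕ con 1ℚ) ⊛ (g ⊛ (f ⊛ P)))) ⊕ (ρ ⊛ (g ⊛ (f ⊛ (f ⊛ P))))))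
      regroup = solve 5 (λ x ρ f g P → g :* ((x :* ((K 1ℚ :+ f) :* (K 1ℚ :+ (ρ :* f)))) :* P) :=
                   x :* (((g :* P) :+ ((ρ :+ K 1ℚ) :* (g :* (f :* P)))) :+ (ρ :* (g :* (f :* (f :* P)))))) ≈-refl
    step₀ : ∀ n → Riordan gl fl (suc n) 0 ≡ p * Riordan gl fl n 0 + p * Riordan gl fl n 1
    step₀ n =
      trans (at (≈-trans (⊛-identityʳ gl) column0) (suc n))
      (trans (cong₂ _+_ (ℚP.*-zeroʳ 1ℚ) (xS⊛-suc (R r ⊛ (gl ⊕ (gl ⊛ fl))) n))
      (trans (ℚP.+-identityˡ _)
      (trans (con⊛-at p (gl ⊕ (gl ⊛ fl)) n)
      (trans (ℚP.*-distribˡ-+ p (gl n) ((gl ⊛ fl) n))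
      (cong₂ (λ a b → p * a + p * b) (sym (at (⊛-identityʳ gl) n)) (sym (at (⊛-congʳ gl (⊛-identityʳ fl)) n)))))))
    step : ∀ n k → Riordan gl fl (suc n) (suc k) ≡
           Riordan gl fl n k + (p + 1ℚ) * Riordan gl fl n (suc k) + p * Riordan gl fl n (suc (suc k))
    step n k = trans (at (column-suc (fl ^S k)) (suc n))
      (trans (xS⊛-suc (((gl ⊛ fˡ) ⊕ ((R r ⊕ one) ⊛ (gl ⊛ (fl ⊛ fˡ)))) ⊕ (R r ⊛ (gl ⊛ (fl ⊛ (fl ⊛ fˡ))))) n)
      (cong₂ _+_ (cong (Riordan gl fl n k +_)
                   (trans (at (⊛-congˡ (gl ⊛ (fl ⊛ fˡ)) (≈-sym (con-+ p 1ℚ))) n) (con⊛-at (p + 1ℚ) (gl ⊛ (fl ⊛ fˡ)) n)))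
                 (con⊛-at p (gl ⊛ (fl ⊛ (fl ⊛ fˡ))) n)))
      where
      fˡ : Series
      fˡ = fl ^S k

  Riordan-gL-fL-row0 : ∀ k → Riordan gl fl 0 k ≡ I 0 k
  Riordan-gL-fL-row0 zero    = trans (⊛-0 gl oneS) (cong (_* 1ℚ) gL-0)
  Riordan-gL-fL-row0 (suc k) = Riordan-lowerTriangular gl {fl} fL-0 0 (suc k) (s≤s z≤n)

  L≐Riordan-gL-fL : L r ≐ Riordan gl fl
  L≐Riordan-gL-fL = recurrence-unique (L-recurrence r r≢0) Riordan-gL-fL-recurrence
    (λ k → trans (L-row0 r k) (sym (Riordan-gL-fL-row0 k)))

  L-inverseʳ : (L r ⊙ Niii r) ≐ I
  L-inverseʳ = ≐-trans (⊙-congˡ (Niii r) L≐Riordan-gL-fL) (Riordan-inverse gl (invS 1+rx) (xS ⊛ invS 1+[r+1]x+rx²) fL-0 gl⊛h∘fL h∘fL≈xS)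
    where
    open ≈-Reasoning
    1+rx 1+[r+1]x+rx² : Series
    1+rx          = poly (1ℚ ∷ p ∷ [])
    1+[r+1]x+rx² = poly (1ℚ ∷ (p + 1ℚ) ∷ p ∷ [])
    gl⊛h∘fL : (gl ⊛ (invS 1+rx ∘ˢ fl)) ≈ oneS
    gl⊛h∘fL = begin
      gl ⊛ (invS 1+rx ∘ˢ fl)                       ≈⟨ ⊛-congˡ (invS 1+rx ∘ˢ fl) (≈-trans gL≈1+rfL (≈-sym 1+rx∘fL)) ⟩
      (oneS ⊛ (1+rx ∘ˢ fl)) ⊛ (invS 1+rx ∘ˢ fl)    ≈⟨ ∘ˢ-⊛-invS oneS 1+rx (λ ()) fL-0 ⟩
      oneS                                         ∎
      where
      1+rx∘fL : (oneS ⊛ (1+rx ∘ˢ fl)) ≈ (one ⊕ (R r ⊛ fl))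
      1+rx∘fL = ≈-trans (⊛-identityˡ _) (∘ˢ-poly₂ 1ℚ p fL-0)
    h∘fL≈xS : ((xS ⊛ invS 1+[r+1]x+rx²) ∘ˢ fl) ≈ xS
    h∘fL≈xS = begin
      (xS ⊛ invS 1+[r+1]x+rx²) ∘ˢ fl                                 ≈⟨ ∘ˢ-⊛ xS (invS 1+[r+1]x+rx²) fL-0 ⟩
      (xS ∘ˢ fl) ⊛ (invS 1+[r+1]x+rx² ∘ˢ fl)                         ≈⟨ ⊛-congˡ (invS 1+[r+1]x+rx² ∘ˢ fl) x∘fL ⟩
      (xS ⊛ (1+[r+1]x+rx² ∘ˢ fl)) ⊛ (invS 1+[r+1]x+rx² ∘ˢ fl)         ≈⟨ ∘ˢ-⊛-invS xS 1+[r+1]x+rx² (λ ()) fL-0 ⟩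
      xS                                                             ∎
      where
      factor : ∀ ρ f → ((con 1ℚ ⊕ ((ρ ⊕ con 1ℚ) ⊛ f)) ⊕ (ρ ⊛ (f ⊛ f))) ≈ ((con 1ℚ ⊕ f) ⊛ (con 1ℚ ⊕ (ρ ⊛ f)))
      factor = solve 2 (λ ρ f → (K 1ℚ :+ ((ρ :+ K 1ℚ) :* f)) :+ (ρ :* (f :* f)) := (K 1ℚ :+ f) :* (K 1ℚ :+ (ρ :* f))) ≈-refl
      Q∘fL : (1+[r+1]x+rx² ∘ˢ fl) ≈ ((one ⊕ fl) ⊛ gl)
      Q∘fL = begin
        1+[r+1]x+rx² ∘ˢ fl                                   ≈⟨ ∘ˢ-poly₃ 1ℚ (p + 1ℚ) p fL-0 ⟩
        (one ⊕ (con (p + 1ℚ) ⊛ fl)) ⊕ (R r ⊛ (fl ⊛ fl))      ≈⟨ ⊕-cong (⊕-cong (≈-refl {one}) (⊛-congˡ fl (con-+ p 1ℚ)))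
                                                                      (≈-refl {R r ⊛ (fl ⊛ fl)}) ⟩
        (one ⊕ ((R r ⊕ one) ⊛ fl)) ⊕ (R r ⊛ (fl ⊛ fl))       ≈⟨ factor (R r) fl ⟩
        (one ⊕ fl) ⊛ (one ⊕ (R r ⊛ fl))                      ≈⟨ ⊛-congʳ (one ⊕ fl) (≈-sym gL≈1+rfL) ⟩
        (one ⊕ fl) ⊛ gl                                      ∎
      x∘fL : (xS ∘ˢ fl) ≈ (xS ⊛ (1+[r+1]x+rx² ∘ˢ fl))
      x∘fL = ≈-trans (∘ˢ-xS fL-0) (≈-trans fL≈x[1+fL]gL (⊛-congʳ xS (≈-sym Q∘fL)))

  L-inverseˡ : (Niii r ⊙ L r) ≐ I
  L-inverseˡ = ⊙-inverse-comm (L r) (Niii r) (L-lowerTriangular r)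
    (Riordan-lowerTriangular (invS (poly (1ℚ ∷ p ∷ []))) (xS⊛-0 (invS (poly (1ℚ ∷ (p + 1ℚ) ∷ p ∷ []))))) L-inverseʳ

-- Row sums of A_P(r)

module _ (r : ℤ) where

  private
    p : ℚ
    p = ρ r
    1+x 1+rx : Series
    1+x  = poly (1ℚ ∷ 1ℚ ∷ [])
    1+rx = poly (1ℚ ∷ p ∷ [])
    term : ℕ → ℕ → ℕ → ℚ
    term a b j = ιℕ ((a C j) ℕ.* (b C j)) * p ^ℚ j

  W : ℕ → Series
  W m = (xS ⊛ ((1+x ^S suc m) ⊛ (1+rx ^S suc m))) ⊖ ((1+x ^S suc (suc m)) ⊛ (1+rx ^S m))

  W-suc : ∀ m → W (suc m) ≈ ((1+x ⊛ 1+rx) ⊛ W m)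
  W-suc m = identity xS 1+x 1+rx (1+x ^S suc m) (1+rx ^S m)
    where
    identity : ∀ x a b A B → ((x ⊛ ((a ⊛ A) ⊛ (b ⊛ (b ⊛ B)))) ⊖ ((a ⊛ (a ⊛ A)) ⊛ (b ⊛ B))) ≈
                             ((a ⊛ b) ⊛ ((x ⊛ (A ⊛ (b ⊛ B))) ⊖ ((a ⊛ A) ⊛ B)))
    identity = solve 5 (λ x a b A B → (x :* ((a :* A) :* (b :* (b :* B)))) :- ((a :* (a :* A)) :* (b :* B)) :=
                                      (a :* b) :* ((x :* (A :* (b :* B))) :- ((a :* A) :* B))) ≈-refl

  [1+x][1+rx]⊛-at : ∀ f k → ((1+x ⊛ 1+rx) ⊛ f) (suc (suc k)) ≡ f (suc (suc k)) + (1ℚ + p) * f (suc k) + p * f k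
  [1+x][1+rx]⊛-at f k = trans (at expand (suc (suc k)))
    (cong₂ _+_ (cong (f (suc (suc k)) +_) (trans (con⊛-at (1ℚ + p) (xS ⊛ f) (suc (suc k))) (cong ((1ℚ + p) *_) (xS⊛-suc f (suc k)))))
               (trans (con⊛-at p (xS ⊛ (xS ⊛ f)) (suc (suc k))) (cong (p *_) (trans (xS⊛-suc (xS ⊛ f) (suc k)) (xS⊛-suc f k)))))
    where
    open ≈-Reasoning
    expand : ((1+x ⊛ 1+rx) ⊛ f) ≈ ((f ⊕ (con (1ℚ + p) ⊛ (xS ⊛ f))) ⊕ (R r ⊛ (xS ⊛ (xS ⊛ f))))
    expand = begin
      (1+x ⊛ 1+rx) ⊛ f                                ≈⟨ ⊛-congˡ f (⊛-cong (poly₂≈ 1ℚ 1ℚ) (poly₂≈ 1ℚ p)) ⟩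
      ((one ⊕ (one ⊛ xS)) ⊛ (one ⊕ (R r ⊛ xS))) ⊛ f   ≈⟨ identity xS (R r) f ⟩
      (f ⊕ ((one ⊕ R r) ⊛ (xS ⊛ f))) ⊕ (R r ⊛ (xS ⊛ (xS ⊛ f)))
        ≈⟨ ⊕-cong (⊕-cong (≈-refl {f}) (⊛-congˡ (xS ⊛ f) (≈-sym (con-+ 1ℚ p)))) (≈-refl {R r ⊛ (xS ⊛ (xS ⊛ f))}) ⟩
      (f ⊕ (con (1ℚ + p) ⊛ (xS ⊛ f))) ⊕ (R r ⊛ (xS ⊛ (xS ⊛ f))) ∎
      where
      identity : ∀ x ρ f → (((con 1ℚ ⊕ (con 1ℚ ⊛ x)) ⊛ (con 1ℚ ⊕ (ρ ⊛ x))) ⊛ f) ≈ ((f ⊕ ((con 1ℚ ⊕ ρ) ⊛ (x ⊛ f))) ⊕ (ρ ⊛ (x ⊛ (x ⊛ f))))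
      identity = solve 3 (λ x ρ f → ((K 1ℚ :+ (K 1ℚ :* x)) :* (K 1ℚ :+ (ρ :* x))) :* f :=
                                    (f :+ ((K 1ℚ :+ ρ) :* (x :* f))) :+ (ρ :* (x :* (x :* f)))) ≈-refl

  binomials-at : ∀ a b → ((1+x ^S a) ⊛ (1+rx ^S b)) a ≡ sumTo (suc a) (term a b)
  binomials-at a b = trans (⊛-comm-at (1+x ^S a) (1+rx ^S b) a) (sumTo-cong-< (suc a) λ j j<1+a →
    trans (cong₂ _*_ (binomial-coeff p b j) (trans (binomial-coeff₁ a (a ∸ j)) (B-sym (ℕP.≤-pred j<1+a))))
          (trans (rearrange (B b j) (p ^ℚ j) (B a j)) (cong (_* p ^ℚ j) (sym (ιℕ-* (a C j) (b C j))))))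
    where
    rearrange : ∀ x y z → x * y * z ≡ z * x * y
    rearrange = solve-∀ ℚ-ring

  binomials-extend : ∀ N a b → b < N → sumTo N (term a b) ≡ sumTo (suc N) (term a b)
  binomials-extend N a b b<N = sumTo-extend (suc N) _ (ℕP.n≤1+n N) (λ j N≤j _ →
    trans (cong (λ z → ιℕ ((a C j) ℕ.* z) * p ^ℚ j) (k>n⇒nCk≡0 (ℕP.<-≤-trans b<N N≤j)))
          (trans (cong (λ z → ιℕ z * p ^ℚ j) (ℕP.*-zeroʳ (a C j))) (ℚP.*-zeroˡ (p ^ℚ j))))

  -- The coefficient of x^(m+2) in (1 + rx) W m is the difference of two
  -- copies of Σⱼ C(m+1,j) C(m+2,j) rʲ.
  W-vanishing : ∀ m → W m (suc (suc m)) + p * W m (suc m) ≡ 0ℚ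
  W-vanishing m = begin
    W m (suc (suc m)) + p * W m (suc m)        ≡⟨ sym 1+rx⊛W-at ⟩
    (1+rx ⊛ W m) (suc (suc m))                 ≡⟨ at (distribute xS 1+x 1+rx (1+x ^S suc m) (1+rx ^S m)) (suc (suc m)) ⟩
    (xS ⊛ U) (suc (suc m)) - V (suc (suc m))   ≡⟨ cong (_- V (suc (suc m))) (xS⊛-suc U (suc m)) ⟩
    U (suc m) - V (suc (suc m))                ≡⟨ cong₂ _-_ U-at V-at ⟩
    Σ - Σ                                      ≡⟨ ℚP.+-inverseʳ Σ ⟩
    0ℚ                                         ∎
    where
    open ≡-Reasoning
    U V : Series
    U = (1+x ^S suc m) ⊛ (1+rx ^S suc (suc m))
    V = (1+x ^S suc (suc m)) ⊛ (1+rx ^S suc m)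
    Σ : ℚ
    Σ = sumTo (suc (suc m)) (term (suc (suc m)) (suc m))
    1+rx⊛W-at : (1+rx ⊛ W m) (suc (suc m)) ≡ W m (suc (suc m)) + p * W m (suc m)
    1+rx⊛W-at = trans (poly₂⊛-suc 1ℚ p (W m) (suc m)) (cong (_+ p * W m (suc m)) (ℚP.*-identityˡ (W m (suc (suc m)))))
    U-at : U (suc m) ≡ Σ
    U-at = trans (binomials-at (suc m) (suc (suc m)))
                 (sumTo-cong (suc (suc m)) (λ j → cong (λ z → ιℕ z * p ^ℚ j) (ℕP.*-comm (suc m C j) (suc (suc m) C j))))
    V-at : V (suc (suc m)) ≡ Σ
    V-at = trans (binomials-at (suc (suc m)) (suc m)) (sym (binomials-extend (suc (suc m)) (suc (suc m)) (suc m) ℕP.≤-refl))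
    distribute : ∀ x a b A B → (b ⊛ ((x ⊛ (A ⊛ (b ⊛ B))) ⊖ ((a ⊛ A) ⊛ B))) ≈ ((x ⊛ (A ⊛ (b ⊛ (b ⊛ B)))) ⊖ ((a ⊛ A) ⊛ (b ⊛ B)))
    distribute = solve 5 (λ x a b A B → b :* ((x :* (A :* (b :* B))) :- ((a :* A) :* B)) :=
                                       (x :* (A :* (b :* (b :* B)))) :- ((a :* A) :* (b :* B))) ≈-refl

  W-catalan : ∀ m → W m (suc (suc m)) ≡ catalanGen r (suc m)
  W-catalan m = trans (cong (_- V (suc (suc m))) (xS⊛-suc U (suc m))) (cong₂ _-_
    (trans (binomials-at (suc m) (suc m)) (binomials-extend (suc (suc m)) (suc m) (suc m) ℕP.≤-refl))
    (binomials-at (suc (suc m)) m))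
    where
    U V : Series
    U = (1+x ^S suc m) ⊛ (1+rx ^S suc m)
    V = (1+x ^S suc (suc m)) ⊛ (1+rx ^S m)

  W0≈ : W 0 ≈ (((negS one ⊕ negS xS) ⊕ (R r ⊛ (xS ⊛ xS))) ⊕ (R r ⊛ (xS ⊛ (xS ⊛ xS))))
  W0≈ = begin
    W 0
      ≈⟨ ⊖-cong (⊛-congʳ xS (⊛-cong (⊛-cong 1+x≈ (≈-sym one≈oneS)) (⊛-cong (poly₂≈ 1ℚ p) (≈-sym one≈oneS))))
                (⊛-cong (⊛-cong 1+x≈ (⊛-cong 1+x≈ (≈-sym one≈oneS))) (≈-sym one≈oneS)) ⟩
    (xS ⊛ (((one ⊕ (one ⊛ xS)) ⊛ one) ⊛ ((one ⊕ (R r ⊛ xS)) ⊛ one))) ⊖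
      (((one ⊕ (one ⊛ xS)) ⊛ ((one ⊕ (one ⊛ xS)) ⊛ one)) ⊛ one)
      ≈⟨ identity xS (R r) ⟩
    ((negS one ⊕ negS xS) ⊕ (R r ⊛ (xS ⊛ xS))) ⊕ (R r ⊛ (xS ⊛ (xS ⊛ xS))) ∎
    where
    open ≈-Reasoning
    1+x≈ : 1+x ≈ (one ⊕ (one ⊛ xS))
    1+x≈ = poly₂≈ 1ℚ 1ℚ
    identity : ∀ x ρ → ((x ⊛ (((con 1ℚ ⊕ (con 1ℚ ⊛ x)) ⊛ con 1ℚ) ⊛ ((con 1ℚ ⊕ (ρ ⊛ x)) ⊛ con 1ℚ))) ⊖
                        (((con 1ℚ ⊕ (con 1ℚ ⊛ x)) ⊛ ((con 1ℚ ⊕ (con 1ℚ ⊛ x)) ⊛ con 1ℚ)) ⊛ con 1ℚ)) ≈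
                       (((negS (con 1ℚ) ⊕ negS x) ⊕ (ρ ⊛ (x ⊛ x))) ⊕ (ρ ⊛ (x ⊛ (x ⊛ x))))
    identity = solve 2 (λ x ρ → (x :* (((K 1ℚ :+ (K 1ℚ :* x)) :* K 1ℚ) :* ((K 1ℚ :+ (ρ :* x)) :* K 1ℚ))) :-
                                (((K 1ℚ :+ (K 1ℚ :* x)) :* ((K 1ℚ :+ (K 1ℚ :* x)) :* K 1ℚ)) :* K 1ℚ) :=
                                ((:- K 1ℚ) :+ (:- x)) :+ (ρ :* (x :* x)) :+ (ρ :* (x :* (x :* x)))) ≈-refl

  W0-at : ∀ k → W 0 (suc (suc k)) ≡ p * xS (suc k) + p * xS k
  W0-at k = trans (at W0≈ (suc (suc k)))
    (trans (cong₂ _+_ (cong (0ℚ +_) (trans (con⊛-at p (xS ⊛ xS) (suc (suc k))) (cong (p *_) (xS⊛-suc xS (suc k)))))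
                      (trans (con⊛-at p (xS ⊛ (xS ⊛ xS)) (suc (suc k))) (cong (p *_) (trans (xS⊛-suc (xS ⊛ xS) (suc k)) (xS⊛-suc xS k)))))
    (cong (_+ p * xS k) (ℚP.+-identityˡ (p * xS (suc k)))))

  AB-1 : ∀ k → AB r 1 k ≡ p * xS (suc k) + p * xS k
  AB-1 zero = trans (AB-step₀ r 0) (values p)
    where
    values : ∀ p → p * 1ℚ + 0ℚ ≡ p * 1ℚ + p * 0ℚ
    values = solve-∀ ℚ-ring
  AB-1 (suc zero) = trans (AB-step r 0 0) (values p)
    where
    values : ∀ p → p * 1ℚ + (p + 1ℚ) * 0ℚ + 0ℚ ≡ p * 0ℚ + p * 1ℚ
    values = solve-∀ ℚ-ring
  AB-1 (suc (suc k)) = trans (AB-step r 0 (suc k)) (values p)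
    where
    values : ∀ p → p * 0ℚ + (p + 1ℚ) * 0ℚ + 0ℚ ≡ p * 0ℚ + p * 0ℚ
    values = solve-∀ ℚ-ring

  W-suc-at : ∀ m j → W (suc m) (suc (suc j)) ≡ W m (suc (suc j)) + (1ℚ + p) * W m (suc j) + p * W m j
  W-suc-at m j = trans (at (W-suc m) (suc (suc j))) ([1+x][1+rx]⊛-at (W m) j)

  AB-W : ∀ m k → AB r (suc m) k ≡ W m (suc (suc (m ℕ.+ k)))
  AB-W zero    k       = trans (AB-1 k) (sym (W0-at k))
  AB-W (suc m) zero    = begin
    AB r (suc (suc m)) 0                                          ≡⟨ AB-step₀ r (suc m) ⟩
    p * AB r (suc m) 0 + AB r (suc m) 1                           ≡⟨ cong₂ (λ a b → p * a + b) (trans (AB-W m 0) (W-at (ℕP.+-identityʳ m)))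
                                                                          (trans (AB-W m 1) (W-at (trans (ℕP.+-suc m 0) (cong suc (ℕP.+-identityʳ m))))) ⟩
    p * W m (suc (suc m)) + W m (suc (suc (suc m)))               ≡⟨ add-vanishing p _ _ _ (W-vanishing m) ⟩
    W m (suc (suc (suc m))) + (1ℚ + p) * W m (suc (suc m)) + p * W m (suc m)  ≡⟨ sym (W-suc-at m (suc m)) ⟩
    W (suc m) (suc (suc (suc m)))                                 ≡⟨ cong (λ z → W (suc m) (suc (suc (suc z)))) (sym (ℕP.+-identityʳ m)) ⟩
    W (suc m) (suc (suc (suc m ℕ.+ 0)))                           ∎
    where
    open ≡-Reasoning
    W-at : ∀ {i j} → i ≡ j → W m (suc (suc i)) ≡ W m (suc (suc j))
    W-at = cong (λ z → W m (suc (suc z)))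
    add-vanishing : ∀ p a b c → a + p * c ≡ 0ℚ → p * a + b ≡ b + (1ℚ + p) * a + p * c
    add-vanishing p a b c a+pc≡0 = trans (pad p a b) (trans (cong (b + p * a +_) (sym a+pc≡0)) (regroup p a b c))
      where
      pad : ∀ p a b → p * a + b ≡ b + p * a + 0ℚ
      pad = solve-∀ ℚ-ring
      regroup : ∀ p a b c → b + p * a + (a + p * c) ≡ b + (1ℚ + p) * a + p * c
      regroup = solve-∀ ℚ-ring
  AB-W (suc m) (suc k) = begin
    AB r (suc (suc m)) (suc k)                                      ≡⟨ AB-step r (suc m) k ⟩
    p * AB r (suc m) k + (p + 1ℚ) * AB r (suc m) (suc k) + AB r (suc m) (suc (suc k))
      ≡⟨ cong₂ (λ a b → p * a + (p + 1ℚ) * b + AB r (suc m) (suc (suc k))) (AB-W m k) (trans (AB-W m (suc k)) (W-at (ℕP.+-suc m k))) ⟩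
    p * W m (2+ (m ℕ.+ k)) + (p + 1ℚ) * W m (3+ (m ℕ.+ k)) + AB r (suc m) (suc (suc k))
      ≡⟨ cong (p * W m (2+ (m ℕ.+ k)) + (p + 1ℚ) * W m (3+ (m ℕ.+ k)) +_)
              (trans (AB-W m (suc (suc k))) (W-at (trans (ℕP.+-suc m (suc k)) (cong suc (ℕP.+-suc m k))))) ⟩
    p * W m (2+ (m ℕ.+ k)) + (p + 1ℚ) * W m (3+ (m ℕ.+ k)) + W m (4+ (m ℕ.+ k))
      ≡⟨ reverse p (W m (2+ (m ℕ.+ k))) (W m (3+ (m ℕ.+ k))) (W m (4+ (m ℕ.+ k))) ⟩
    W m (4+ (m ℕ.+ k)) + (1ℚ + p) * W m (3+ (m ℕ.+ k)) + p * W m (2+ (m ℕ.+ k))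
      ≡⟨ sym (W-suc-at m (2+ (m ℕ.+ k))) ⟩
    W (suc m) (4+ (m ℕ.+ k))                                         ≡⟨ cong (λ z → W (suc m) (3+ z)) (sym (ℕP.+-suc m k)) ⟩
    W (suc m) (3+ (m ℕ.+ suc k))                                     ∎
    where
    open ≡-Reasoning
    2+_ 3+_ 4+_ : ℕ → ℕ
    2+ n = suc (suc n)
    3+ n = suc (2+ n)
    4+ n = suc (3+ n)
    W-at : ∀ {i j} → i ≡ j → W m (suc (suc i)) ≡ W m (suc (suc j))
    W-at = cong (λ z → W m (suc (suc z)))
    reverse : ∀ p a b c → p * a + (p + 1ℚ) * b + c ≡ c + (1ℚ + p) * b + p * a
    reverse = solve-∀ ℚ-ring

  AB-column0 : ∀ n → AB r n 0 ≡ catalanGen r n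
  AB-column0 zero    = sym (value p)
    where
    value : ∀ p → 0ℚ + 1ℚ * 1ℚ + 0ℚ * (p * 1ℚ) - 0ℚ ≡ 1ℚ
    value = solve-∀ ℚ-ring
  AB-column0 (suc m) = trans (AB-W m 0) (trans (cong (λ z → W m (suc (suc z))) (ℕP.+-identityʳ m)) (W-catalan m))

  AP-rowSum : ∀ n → sumTo (suc n) (AP r n) ≡ catalanGen r n
  AP-rowSum n = trans (sumTo-cong (suc n) (λ j → sym (ℚP.*-identityʳ (AP r n j)))) (AB-column0 n)

hankel-decomposition : ∀ r → r ≢ ℤ.+ 0 → H r ≐ ((L r ⊙ D r) ⊙ transpose (L r))
hankel-decomposition r r≢0 i j =
  sym (trans (Hankel.LDLᵀ≡column0 (L-recurrence r r≢0) (L-lowerTriangular r) (L-row0 r) i j) (L-column0 (i ℕ.+ j)))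
  where
  L-column0 : ∀ n → L r n 0 ≡ catalanGen r n
  L-column0 n = trans (L-at r n 0) (trans (ℚP.*-identityʳ (AB r n 0)) (AB-column0 r n))

mainTheorem4 : (r : ℤ) → r ≢ ℤ.+ 0 →
    -- (i) P(r) is the production matrix of c(n;r): row sums of A_P(r)
    ((n : ℕ) → sumTo (suc n) (AP r n) ≡ catalanGen r n)
    -- (ii) A_P(r) = (1, x(1-x)/(r-(r-1)x))^(-1) = (1, (1+(r-1)x-sqrt Δ)/2)
    × ((AP r ⊙ Riordan oneS (Fii r)) ≐ I)
    × ((Riordan oneS (Fii r) ⊙ AP r) ≐ I)
    × (AP r ≐ Riordan oneS (Gii r))
    -- (iii) L(r) = A_P(r) B (1,x/r) is the stated Riordan array,
    -- equal to (1/(1+rx), x/(1+(r+1)x+rx^2))^(-1), and H(r) = L D L^T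
    × (L r ≐ Riordan (gL r) (fL r))
    × ((L r ⊙ Niii r) ≐ I)
    × ((Niii r ⊙ L r) ≐ I)
    × (H r ≐ ((L r ⊙ D r) ⊙ transpose (L r)))
mainTheorem4 r r≢0 =
  AP-rowSum r , AP-inverseʳ r r≢0 , AP-inverseˡ r r≢0 , AP≐RG r ,
  L≐Riordan-gL-fL r r≢0 , L-inverseʳ r r≢0 , L-inverseˡ r r≢0 , hankel-decomposition r r≢0
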